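{- Let $x\in\mathbb{R}$ be irrational. Then the set $\Gamma(x)=\{\gamma_1,\gamma_2,\gamma_3,\ldots\}\subset\Gamma$ equals $W\setminus(W_1\cup W_2)$, where $$W=\{\gamma\in\Gamma \mid -1\leq\gamma(\infty)\leq0,\ \gamma(x)>1\},$$ $$W_1=\{\gamma\in W\mid \gamma(\infty)=0,\ \det(\gamma)=1\},\qquad W_2=\{\gamma\in W\mid \gamma(\infty)=-1,\ \det(\gamma)=-1\}.$$ Moreover, $W_1$ has exactly one element and $W_2$ has at most one element.
   Context: $\Gamma=\mathrm{PGL}_2(\mathbb{Z})$ acts on $\mathbb{P}^1(\mathbb{R})=\mathbb{R}\cup\{\infty\}$ by $\begin{pmatrix}a&b\\c&d\end{pmatrix}x=\frac{ax+b}{cx+d}$; the determinant $\det(\gamma)\in\{\pm1\}$ is well defined on $\Gamma$. Let $\varepsilon=\begin{pmatrix}0&1\\1&0\end{pmatrix}$ and $T=\begin{pmatrix}1&1\\0&1\end{pmatrix}$. For irrational $x$, its classic continued fraction $x=[n_0,n_1,\ldots]$ ($n_0\in\mathbb{Z}$, $n_i\geq1$ for $i\geq1$) is produced by $x_0=x$, $n_i=\lfloor x_i\rfloor$, $x_{i+1}=\frac{1}{x_i-n_i}=\varepsilon T^{ -n_i}(x_i)$ for $i\geq0$. Define $\gamma_0=\mathrm{Id}$ and $\gamma_{i+1}=\varepsilon T^{ -n_i}\gamma_i$ for $i\geq0$, i.e. $\gamma_i=\begin{pmatrix}0&1\\1&-n_{i-1}\end{pmatrix}\cdots\begin{pmatrix}0&1\\1&-n_0\end{pmatrix}$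 for $i\geq1$, so that $x_i=\gamma_i(x)$. Set $\Gamma(x)=\{\gamma_1,\gamma_2,\gamma_3,\ldots\}$ (as an unordered set). The conditions $-1\leq\gamma(\infty)\leq0$ in particular require $\gamma(\infty)\neq\infty$. -}

module Defs where

open import Data.Bool using (Bool; true; false)
open import Data.Nat using (ℕ; zero; suc)
open import Data.Integer as ℤ using (ℤ; +_; -[1+_])
open import Data.Rational as ℚ using (ℚ; _/_; 0ℚ; 1ℚ)
open import Data.Maybe using (Maybe; just; nothing)
open import Data.Product using (Σ; ∃; _×_; _,_)
open import Data.Sum using (_⊎_)
open import Relation.Binary.PropositionalEquality using (_≡_)

-- Irrational real numbers, as Dedekind cuts of ℚ with no rational
-- boundary.  `below q ≡ true` means q < x, `below q ≡ false` means
-- q > x (x irrational, so q ≠ x for every rational q).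

record Irrational : Set where
  field
    below  : ℚ → Bool
    down   : ∀ p q → p ℚ.≤ q → below q ≡ true → below p ≡ true
    inhabL : ∃ λ q → below q ≡ true
    inhabU : ∃ λ q → below q ≡ false
    noMax  : ∀ q → below q ≡ true → ∃ λ r → q ℚ.< r × below r ≡ true
    noMin  : ∀ q → below q ≡ false → ∃ λ r → r ℚ.< q × below r ≡ false
open Irrational public

ℤ→ℚ : ℤ → ℚ
ℤ→ℚ z = z / 1

-- α·x + β > 0  (α, β rational, x irrational): the affine function
-- t ↦ α t + β is positive on some rational interval (r , s) ∋ x,
-- i.e. at both endpoints r < x < s.
Pos : Irrational → ℚ → ℚ → Set
Pos x α β = Σ ℚ λ r → Σ ℚ λ s →
  below x r ≡ true × below x s ≡ false ×
  0ℚ ℚ.< α ℚ.* r ℚ.+ β × 0ℚ ℚ.< α ℚ.* s ℚ.+ β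

-- 2×2 integer matrices; elements of PGL₂(ℤ) are unimodular matrices
-- taken up to the sign ±1.

record M2 : Set where
  constructor mat
  field
    a b c d : ℤ
open M2 public

det : M2 → ℤ
det g = a g ℤ.* d g ℤ.- b g ℤ.* c g

Unimodular : M2 → Set
Unimodular g = det g ≡ ℤ.+ 1 ⊎ det g ≡ ℤ.- (ℤ.+ 1)

negM : M2 → M2
negM (mat a b c d) = mat (ℤ.- a) (ℤ.- b) (ℤ.- c) (ℤ.- d)

_~_ : M2 → M2 → Set
g ~ h = h ≡ g ⊎ h ≡ negM g

_·_ : M2 → M2 → M2
mat a b c d · mat a' b' c' d' =
  mat (a ℤ.* a' ℤ.+ b ℤ.* c') (a ℤ.* b' ℤ.+ b ℤ.* d')
      (c ℤ.* a' ℤ.+ d ℤ.* c') (c ℤ.* b' ℤ.+ d ℤ.* d')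

Id : M2
Id = mat (+ 1) (+ 0) (+ 0) (+ 1)

ε : M2
ε = mat (+ 0) (+ 1) (+ 1) (+ 0)

Tinv : ℤ → M2
Tinv n = mat (+ 1) (ℤ.- n) (+ 0) (+ 1)

-- Möbius action on an irrational x, compared with rationals.
-- g(x) = (a x + b)/(c x + d);  g(x) - q = ((a - q c) x + (b - q d))/(c x + d).

-- q < g(x)
ActGt : Irrational → M2 → ℚ → Set
ActGt x (mat a b c d) q =
    (Pos x (A ℚ.- q ℚ.* C) (B ℚ.- q ℚ.* D) × Pos x C D)
  ⊎ (Pos x (q ℚ.* C ℚ.- A) (q ℚ.* D ℚ.- B) × Pos x (ℚ.- C) (ℚ.- D))
  where A = ℤ→ℚ a ; B = ℤ→ℚ b ; C = ℤ→ℚ c ; D = ℤ→ℚ d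

-- g(x) < q
ActLt : Irrational → M2 → ℚ → Set
ActLt x (mat a b c d) q =
    (Pos x (q ℚ.* C ℚ.- A) (q ℚ.* D ℚ.- B) × Pos x C D)
  ⊎ (Pos x (A ℚ.- q ℚ.* C) (B ℚ.- q ℚ.* D) × Pos x (ℚ.- C) (ℚ.- D))
  where A = ℤ→ℚ a ; B = ℤ→ℚ b ; C = ℤ→ℚ c ; D = ℤ→ℚ d

-- g(∞) = a / c  (nothing encodes ∞, i.e. c = 0)
atInf : M2 → Maybe ℚ
atInf (mat a b (+ zero) d)    = nothing
atInf (mat a b (+ (suc n)) d) = just (a / suc n)
atInf (mat a b -[1+ n ] d)    = just (ℤ.- a / suc n)

-- The continued-fraction matrices: CF x i g  means  g = γ_i.
-- n_i = ⌊γ_i(x)⌋ is characterised by n_i < γ_i(x) < n_i + 1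
-- (strict, as γ_i(x) is irrational); γ_{i+1} = ε T^{-n_i} γ_i.

data CF (x : Irrational) : ℕ → M2 → Set where
  cf0 : CF x zero Id
  cfS : ∀ {i g} → CF x i g → (n : ℤ) →
        ActGt x g (ℤ→ℚ n) → ActLt x g (ℤ→ℚ (n ℤ.+ + 1)) →
        CF x (suc i) ((ε · Tinv n) · g)

InΓx : Irrational → M2 → Set
InΓx x γ = ∃ λ i → ∃ λ g → CF x (suc i) g × g ~ γ

W : Irrational → M2 → Set
W x γ = (Σ ℚ λ q → atInf γ ≡ just q × ℚ.- 1ℚ ℚ.≤ q × q ℚ.≤ 0ℚ)
        × ActGt x γ 1ℚ

W₁ : Irrational → M2 → Set
W₁ x γ = W x γ × atInf γ ≡ just 0ℚ × det γ ≡ + 1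

W₂ : Irrational → M2 → Set
W₂ x γ = W x γ × atInf γ ≡ just (ℚ.- 1ℚ) × det γ ≡ ℤ.- (+ 1)

module Submission where

-- Every comparison at x is a sign condition on integer linear forms p x + q
-- (module Sign): a nonzero form has a definite sign at the irrational x, and
-- g(x) > n, g(x) < n say that two forms have the same sign at x.
--
-- Call h reduced if its first column is (j, −(k+1)) with 0 ≤ j ≤ k+1 (that
-- is, h(∞) ∈ [−1, 0]), h(x) > 1, and h avoids the W₁ and W₂ conditions
-- (module Reduction).  Forwards, γ₁ is reduced up to sign and each step
-- γ ↦ ε T^{-n} γ with n = ⌊γ(x)⌋ preserves this.  Backwards, a reduced h with
-- j ≥ 1 equals ε T^{-M} P with −P reduced of smaller size k + j; the
-- multiplier M comes from dividing k+1 by j (`multiplier`).  The descent ends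
-- at h(∞) = 0, which forces h = ±γ₁.  As elements of W ∖ (W₁ ∪ W₂) are reduced
-- up to sign, this proves part 1 (module Classification).
--
-- Finally W₁ = {±[[0, 1], [−1, d]]} where d − 1 < x < d, and W₂ consists of
-- matrices ±[[−1, b], [1, 1 − b]] where b − 1 < x < b − 1/2.  Such integers
-- d, b are unique, and d exists by a search between integer bounds for x.

open import Defs
open import Data.Bool using (true; false)
open import Data.Nat as ℕ using (ℕ; zero; suc)
import Data.Nat.Properties as ℕP
import Data.Nat.DivMod as ℕD
open import Data.Integer as ℤ using (ℤ; +_; -[1+_])
import Data.Integer.Properties as ℤP
open import Data.Integer.Tactic.RingSolver using (solve-∀)
open import Data.Rational as ℚ using (ℚ; mkℚ; _/_; 0ℚ; 1ℚ)
import Data.Rational.Properties as ℚP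
import Data.Rational.Unnormalised as ℚᵘ
import Data.Rational.Unnormalised.Properties as ℚᵘP
open import Data.Rational.Solver using (module +-*-Solver)
open import Data.Maybe using (just)
open import Data.Maybe.Properties using (just-injective)
open import Data.Product using (Σ; ∃; _×_; _,_; proj₁; proj₂)
open import Data.Sum using (_⊎_; inj₁; inj₂)
open import Data.Empty using (⊥; ⊥-elim)
open import Relation.Nullary using (¬_; yes; no)
open import Relation.Nullary.Decidable using (_×-dec_)
open import Relation.Binary.PropositionalEquality
open import Relation.Binary.Definitions using (tri<; tri≈; tri>)
open import Function.Bundles using (_⇔_; mk⇔)

-- Fractions z / (k+1) seen as unnormalised rationals; comparisons of
-- fractions then reduce to cross-multiplication in ℤ.
toℚᵘ-/ : ∀ z k → ℚᵘ._≃_ (ℚ.toℚᵘ (z / suc k)) (ℚᵘ.mkℚᵘ z k)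
toℚᵘ-/ z k = ℚP.toℚᵘ-fromℚᵘ (ℚᵘ.mkℚᵘ z k)

frac-≤ : ∀ z k w l → z / suc k ℚ.≤ w / suc l → z ℤ.* + suc l ℤ.≤ w ℤ.* + suc k
frac-≤ z k w l le with ℚᵘP.≤-respʳ-≃ (toℚᵘ-/ w l) (ℚᵘP.≤-respˡ-≃ (toℚᵘ-/ z k) (ℚP.toℚᵘ-mono-≤ le))
... | ℚᵘ.*≤* cross = cross

frac-≤⁻ : ∀ z k w l → z ℤ.* + suc l ℤ.≤ w ℤ.* + suc k → z / suc k ℚ.≤ w / suc l
frac-≤⁻ z k w l cross = ℚP.toℚᵘ-cancel-≤
  (ℚᵘP.≤-respʳ-≃ (ℚᵘP.≃-sym (toℚᵘ-/ w l)) (ℚᵘP.≤-respˡ-≃ (ℚᵘP.≃-sym (toℚᵘ-/ z k)) (ℚᵘ.*≤* cross)))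

frac-< : ∀ z k w l → z / suc k ℚ.< w / suc l → z ℤ.* + suc l ℤ.< w ℤ.* + suc k
frac-< z k w l lt with ℚᵘP.<-respʳ-≃ (toℚᵘ-/ w l) (ℚᵘP.<-respˡ-≃ (toℚᵘ-/ z k) (ℚP.toℚᵘ-mono-< lt))
... | ℚᵘ.*<* cross = cross

frac-<⁻ : ∀ z k w l → z ℤ.* + suc l ℤ.< w ℤ.* + suc k → z / suc k ℚ.< w / suc l
frac-<⁻ z k w l cross = ℚP.toℚᵘ-cancel-<
  (ℚᵘP.<-respʳ-≃ (ℚᵘP.≃-sym (toℚᵘ-/ w l)) (ℚᵘP.<-respˡ-≃ (ℚᵘP.≃-sym (toℚᵘ-/ z k)) (ℚᵘ.*<* cross)))

frac-≡ : ∀ z k w l → z / suc k ≡ w / suc l → z ℤ.* + suc l ≡ w ℤ.* + suc k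
frac-≡ z k w l e with ℚᵘP.≃-trans (ℚᵘP.≃-sym (toℚᵘ-/ z k)) (ℚᵘP.≃-trans (ℚP.toℚᵘ-cong e) (toℚᵘ-/ w l))
... | ℚᵘ.*≡* cross = cross

frac-≡⁻ : ∀ z k w l → z ℤ.* + suc l ≡ w ℤ.* + suc k → z / suc k ≡ w / suc l
frac-≡⁻ z k w l cross =
  ℚP.toℚᵘ-injective (ℚᵘP.≃-trans (toℚᵘ-/ z k) (ℚᵘP.≃-trans (ℚᵘ.*≡* cross) (ℚᵘP.≃-sym (toℚᵘ-/ w l))))

ℤ→ℚ-+ : ∀ p q → ℤ→ℚ (p ℤ.+ q) ≡ ℤ→ℚ p ℚ.+ ℤ→ℚ q
ℤ→ℚ-+ p q = ℚP.toℚᵘ-injective (ℚᵘP.≃-trans (toℚᵘ-/ (p ℤ.+ q) 0) (ℚᵘP.≃-trans (ℚᵘ.*≡* (ring p q))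
  (ℚᵘP.≃-sym (ℚᵘP.≃-trans (ℚP.toℚᵘ-homo-+ (ℤ→ℚ p) (ℤ→ℚ q)) (ℚᵘP.+-cong (toℚᵘ-/ p 0) (toℚᵘ-/ q 0))))))
  where
  ring : ∀ p q → (p ℤ.+ q) ℤ.* + 1 ≡ (p ℤ.* + 1 ℤ.+ q ℤ.* + 1) ℤ.* + 1
  ring = solve-∀

ℤ→ℚ-* : ∀ p q → ℤ→ℚ (p ℤ.* q) ≡ ℤ→ℚ p ℚ.* ℤ→ℚ q
ℤ→ℚ-* p q = ℚP.toℚᵘ-injective (ℚᵘP.≃-trans (toℚᵘ-/ (p ℤ.* q) 0)
  (ℚᵘP.≃-sym (ℚᵘP.≃-trans (ℚP.toℚᵘ-homo-* (ℤ→ℚ p) (ℤ→ℚ q)) (ℚᵘP.*-cong (toℚᵘ-/ p 0) (toℚᵘ-/ q 0)))))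

ℤ→ℚ-neg : ∀ p → ℤ→ℚ (ℤ.- p) ≡ ℚ.- ℤ→ℚ p
ℤ→ℚ-neg p = ℚP.toℚᵘ-injective (ℚᵘP.≃-trans (toℚᵘ-/ (ℤ.- p) 0)
  (ℚᵘP.≃-sym (ℚᵘP.≃-trans (ℚP.toℚᵘ-homo‿- (ℤ→ℚ p)) (ℚᵘP.-‿cong (toℚᵘ-/ p 0)))))

ℤ→ℚ-- : ∀ p q → ℤ→ℚ (p ℤ.- q) ≡ ℤ→ℚ p ℚ.- ℤ→ℚ q
ℤ→ℚ-- p q = trans (ℤ→ℚ-+ p (ℤ.- q)) (cong (ℤ→ℚ p ℚ.+_) (ℤ→ℚ-neg q))

ℤ→ℚ-sub-mul : ∀ a n c → ℤ→ℚ (a ℤ.- n ℤ.* c) ≡ ℤ→ℚ a ℚ.- ℤ→ℚ n ℚ.* ℤ→ℚ c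
ℤ→ℚ-sub-mul a n c = trans (ℤ→ℚ-- a (n ℤ.* c)) (cong (λ w → ℤ→ℚ a ℚ.- w) (ℤ→ℚ-* n c))

ℤ→ℚ-mul-sub : ∀ a n c → ℤ→ℚ (n ℤ.* c ℤ.- a) ≡ ℤ→ℚ n ℚ.* ℤ→ℚ c ℚ.- ℤ→ℚ a
ℤ→ℚ-mul-sub a n c = trans (ℤ→ℚ-- (n ℤ.* c) a) (cong (ℚ._- ℤ→ℚ a) (ℤ→ℚ-* n c))

ℤ→ℚ-cancel-< : ∀ {p q} → ℤ→ℚ p ℚ.< ℤ→ℚ q → p ℤ.< q
ℤ→ℚ-cancel-< {p} {q} lt = subst₂ ℤ._<_ (ℤP.*-identityʳ p) (ℤP.*-identityʳ q) (frac-< p 0 q 0 lt)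

ℤ→ℚ-mono-< : ∀ {p q} → p ℤ.< q → ℤ→ℚ p ℚ.< ℤ→ℚ q
ℤ→ℚ-mono-< {p} {q} lt = frac-<⁻ p 0 q 0 (subst₂ ℤ._<_ (sym (ℤP.*-identityʳ p)) (sym (ℤP.*-identityʳ q)) lt)

ℤ→ℚ-zero : ∀ {p} → ℤ→ℚ p ≡ 0ℚ → p ≡ + 0
ℤ→ℚ-zero {p} e = trans (sym (ℤP.*-identityʳ p)) (frac-≡ p 0 (+ 0) 0 e)

ℚ-lower-int : ∀ q → ℤ→ℚ (ℤ.- (+ ℤ.∣ ℚ.↥ q ∣)) ℚ.≤ q
ℚ-lower-int q@(mkℚ n dm _) =
  subst (ℤ→ℚ (ℤ.- (+ ℤ.∣ n ∣)) ℚ.≤_) (ℚP.↥p/↧p≡p q) (frac-≤⁻ (ℤ.- (+ ℤ.∣ n ∣)) 0 n dm (bound n))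
  where
  bound : ∀ n → ℤ.- (+ ℤ.∣ n ∣) ℤ.* + suc dm ℤ.≤ n ℤ.* + 1
  bound (+ m) = subst₂ ℤ._≤_ (trans (cong ℤ.-_ (ℤP.pos-* m (suc dm))) (ℤP.neg-distribˡ-* (+ m) (+ suc dm)))
                             (sym (ℤP.*-identityʳ (+ m))) ℤP.neg-≤-pos
  bound -[1+ m ] = subst (-[1+ m ] ℤ.* + suc dm ℤ.≤_) (sym (ℤP.*-identityʳ -[1+ m ]))
                         (ℤ.-≤- (ℕP.≤-trans (ℕP.m≤m*n m (suc dm)) (ℕP.m≤n+m _ dm)))

ℚ-upper-int : ∀ q → q ℚ.≤ ℤ→ℚ (+ ℤ.∣ ℚ.↥ q ∣)
ℚ-upper-int q@(mkℚ n dm _) =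
  subst (ℚ._≤ ℤ→ℚ (+ ℤ.∣ n ∣)) (ℚP.↥p/↧p≡p q) (frac-≤⁻ n dm (+ ℤ.∣ n ∣) 0 (bound n))
  where
  bound : ∀ n → n ℤ.* + 1 ℤ.≤ + ℤ.∣ n ∣ ℤ.* + suc dm
  bound (+ m) = subst₂ ℤ._≤_ (sym (ℤP.*-identityʳ (+ m))) (ℤP.pos-* m (suc dm)) (ℤ.+≤+ (ℕP.m≤m*n m (suc dm)))
  bound -[1+ m ] = subst (ℤ._≤ + suc m ℤ.* + suc dm) (sym (ℤP.*-identityʳ -[1+ m ])) ℤ.-≤+

frac-in-[-1,0] : ∀ z k → ℚ.- 1ℚ ℚ.≤ z / suc k → z / suc k ℚ.≤ 0ℚ → Σ ℕ λ j → j ℕ.≤ suc k × z ≡ ℤ.- (+ j)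
frac-in-[-1,0] z k -1≤ ≤0 =
  bounded z (subst₂ ℤ._≤_ (ℤP.-1*i≡-i (+ suc k)) (ℤP.*-identityʳ z) (frac-≤ -[1+ 0 ] 0 z k -1≤))
            (subst₂ ℤ._≤_ (ℤP.*-identityʳ z) (ℤP.*-zeroˡ (+ suc k)) (frac-≤ z k (+ 0) 0 ≤0))
  where
  bounded : ∀ z → -[1+ k ] ℤ.≤ z → z ℤ.≤ + 0 → Σ ℕ λ j → j ℕ.≤ suc k × z ≡ ℤ.- (+ j)
  bounded (+ zero) _ _ = 0 , ℕ.z≤n , refl
  bounded (+ suc i) _ (ℤ.+≤+ ())
  bounded -[1+ i ] (ℤ.-≤- i≤k) _ = suc i , ℕ.s≤s i≤k , refl

frac-in-[-1,0]⁻ : ∀ j k → j ℕ.≤ suc k → ℚ.- 1ℚ ℚ.≤ ℤ.- (+ j) / suc k × ℤ.- (+ j) / suc k ℚ.≤ 0ℚ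
frac-in-[-1,0]⁻ j k j≤ =
  frac-≤⁻ -[1+ 0 ] 0 (ℤ.- (+ j)) k (subst₂ ℤ._≤_ (sym (ℤP.-1*i≡-i (+ suc k))) (sym (ℤP.*-identityʳ _)) (lower j j≤)) ,
  frac-≤⁻ (ℤ.- (+ j)) k (+ 0) 0 (subst₂ ℤ._≤_ (sym (ℤP.*-identityʳ _)) (sym (ℤP.*-zeroˡ (+ suc k))) (upper j))
  where
  lower : ∀ j → j ℕ.≤ suc k → -[1+ k ] ℤ.≤ ℤ.- (+ j)
  lower zero _ = ℤ.-≤+
  lower (suc i) (ℕ.s≤s i≤k) = ℤ.-≤- i≤k
  upper : ∀ j → ℤ.- (+ j) ℤ.≤ + 0
  upper zero = ℤ.+≤+ ℕ.z≤n
  upper (suc i) = ℤ.-≤+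

ℤ-neg-sub : ∀ u v → ℤ.- (u ℤ.- v) ≡ v ℤ.- u
ℤ-neg-sub = solve-∀

ℤ-add-sub : ∀ b d → (b ℤ.+ d) ℤ.- b ≡ d
ℤ-add-sub = solve-∀

ℤ-unit : ∀ b c → b ℤ.* c ≡ + 1 → (b ≡ + 1 × c ≡ + 1) ⊎ (b ≡ -[1+ 0 ] × c ≡ -[1+ 0 ])
ℤ-unit b c bc≡1 = signs (abs≡1 b (ℕP.m*n≡1⇒m≡1 ℤ.∣ b ∣ ℤ.∣ c ∣ ∣bc∣≡1))
                        (abs≡1 c (ℕP.m*n≡1⇒n≡1 ℤ.∣ b ∣ ℤ.∣ c ∣ ∣bc∣≡1)) bc≡1
  where
  ∣bc∣≡1 : ℤ.∣ b ∣ ℕ.* ℤ.∣ c ∣ ≡ 1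
  ∣bc∣≡1 = trans (sym (ℤP.abs-* b c)) (cong ℤ.∣_∣ bc≡1)
  abs≡1 : ∀ z → ℤ.∣ z ∣ ≡ 1 → z ≡ + 1 ⊎ z ≡ -[1+ 0 ]
  abs≡1 (+ 1) _ = inj₁ refl
  abs≡1 -[1+ 0 ] _ = inj₂ refl
  abs≡1 (+ 0) ()
  abs≡1 (+ suc (suc n)) ()
  abs≡1 -[1+ suc n ] ()
  signs : ∀ {b c} → b ≡ + 1 ⊎ b ≡ -[1+ 0 ] → c ≡ + 1 ⊎ c ≡ -[1+ 0 ] → b ℤ.* c ≡ + 1 →
          (b ≡ + 1 × c ≡ + 1) ⊎ (b ≡ -[1+ 0 ] × c ≡ -[1+ 0 ])
  signs (inj₁ refl) (inj₁ refl) _ = inj₁ (refl , refl)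
  signs (inj₁ refl) (inj₂ refl) ()
  signs (inj₂ refl) (inj₁ refl) ()
  signs (inj₂ refl) (inj₂ refl) _ = inj₂ (refl , refl)

-1≢1 : -[1+ 0 ] ≢ + 1
-1≢1 ()

ℤ-pos-suc : ∀ e → + 0 ℤ.< + 1 ℤ.+ e → + 0 ℤ.≤ e
ℤ-pos-suc e lt = subst (+ 0 ℤ.≤_) (ring e) (ℤP.i<j⇒i≤pred[j] lt)
  where
  ring : ∀ e → -[1+ 0 ] ℤ.+ (+ 1 ℤ.+ e) ≡ e
  ring = solve-∀

ℤ-nonneg-double : ∀ e → + 0 ℤ.≤ + 2 ℤ.* e → + 0 ℤ.≤ e
ℤ-nonneg-double (+ n) _ = ℤ.+≤+ ℕ.z≤n
ℤ-nonneg-double -[1+ m ] ()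

mat-≡ : ∀ {a b c d a′ b′ c′ d′} → a ≡ a′ → b ≡ b′ → c ≡ c′ → d ≡ d′ → mat a b c d ≡ mat a′ b′ c′ d′
mat-≡ refl refl refl refl = refl

step : ℤ → M2 → M2
step n g = mat (c g) (d g) (a g ℤ.- n ℤ.* c g) (b g ℤ.- n ℤ.* d g)

step-≡ : ∀ n g → (ε · Tinv n) · g ≡ step n g
step-≡ n (mat a b c d) = mat-≡ (top n a c) (top n b d) (bottom n a c) (bottom n b d)
  where
  top : ∀ n a c → (+ 0 ℤ.* + 1 ℤ.+ + 1 ℤ.* + 0) ℤ.* a ℤ.+ (+ 0 ℤ.* ℤ.- n ℤ.+ + 1 ℤ.* + 1) ℤ.* c ≡ c
  top = solve-∀
  bottom : ∀ n a c → (+ 1 ℤ.* + 1 ℤ.+ + 0 ℤ.* + 0) ℤ.* a ℤ.+ (+ 1 ℤ.* ℤ.- n ℤ.+ + 0 ℤ.* + 1) ℤ.* c ≡ a ℤ.- n ℤ.* c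
  bottom = solve-∀

det-step : ∀ n g → det (step n g) ≡ ℤ.- det g
det-step n (mat a b c d) = ring n a b c d
  where
  ring : ∀ n a b c d → c ℤ.* (b ℤ.- n ℤ.* d) ℤ.- d ℤ.* (a ℤ.- n ℤ.* c) ≡ ℤ.- (a ℤ.* d ℤ.- b ℤ.* c)
  ring = solve-∀

det-neg : ∀ g → det (negM g) ≡ det g
det-neg (mat a b c d) = ring a b c d
  where
  ring : ∀ a b c d → ℤ.- a ℤ.* ℤ.- d ℤ.- ℤ.- b ℤ.* ℤ.- c ≡ a ℤ.* d ℤ.- b ℤ.* c
  ring = solve-∀

negM-involutive : ∀ g → negM (negM g) ≡ g
negM-involutive (mat a b c d) =
  mat-≡ (ℤP.neg-involutive a) (ℤP.neg-involutive b) (ℤP.neg-involutive c) (ℤP.neg-involutive d)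

step-neg : ∀ n g → step n (negM g) ≡ negM (step n g)
step-neg n (mat a b c d) = mat-≡ refl refl (ring n a c) (ring n b d)
  where
  ring : ∀ n a c → ℤ.- a ℤ.- n ℤ.* ℤ.- c ≡ ℤ.- (a ℤ.- n ℤ.* c)
  ring = solve-∀

parent : ℤ → M2 → M2
parent M (mat a b c d) = mat (c ℤ.+ M ℤ.* a) (d ℤ.+ M ℤ.* b) a b

step-parent : ∀ M h → step M (parent M h) ≡ h
step-parent M (mat a b c d) = mat-≡ refl refl (ring c M a) (ring d M b)
  where
  ring : ∀ c M a → c ℤ.+ M ℤ.* a ℤ.- M ℤ.* a ≡ c
  ring = solve-∀

det-parent : ∀ M h → det (negM (parent M h)) ≡ ℤ.- det h
det-parent M h = trans (det-neg (parent M h)) (trans (sym (ℤP.neg-involutive _))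
                   (cong ℤ.-_ (trans (sym (det-step M (parent M h))) (cong det (step-parent M h)))))

~-sym : ∀ {g h} → g ~ h → h ~ g
~-sym {g} (inj₁ refl) = inj₁ refl
~-sym {g} (inj₂ refl) = inj₂ (sym (negM-involutive g))

~-trans : ∀ {g h k} → g ~ h → h ~ k → g ~ k
~-trans (inj₁ refl) h~k = h~k
~-trans {g} (inj₂ refl) (inj₁ refl) = inj₂ refl
~-trans {g} (inj₂ refl) (inj₂ refl) = inj₁ (negM-involutive g)

±1-neg : ∀ {z} → (z ≡ + 1 ⊎ z ≡ ℤ.- (+ 1)) → (ℤ.- z ≡ + 1 ⊎ ℤ.- z ≡ ℤ.- (+ 1))
±1-neg (inj₁ refl) = inj₂ refl
±1-neg (inj₂ refl) = inj₁ refl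

det≢1 : ∀ {g} → Unimodular g → det g ≢ + 1 → det g ≡ -[1+ 0 ]
det≢1 (inj₁ e) ≢1 = ⊥-elim (≢1 e)
det≢1 (inj₂ e) _ = e

Unimodular-step : ∀ n g → Unimodular g → Unimodular (step n g)
Unimodular-step n g u = subst (λ z → z ≡ + 1 ⊎ z ≡ ℤ.- (+ 1)) (sym (det-step n g)) (±1-neg u)

Unimodular-neg : ∀ g → Unimodular g → Unimodular (negM g)
Unimodular-neg g u = subst (λ z → z ≡ + 1 ⊎ z ≡ ℤ.- (+ 1)) (sym (det-neg g)) u

InfInUnit : M2 → Set
InfInUnit γ = Σ ℚ λ q → atInf γ ≡ just q × ℚ.- 1ℚ ℚ.≤ q × q ℚ.≤ 0ℚ

UnitRatio : ℤ → ℤ → Set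
UnitRatio a c = Σ ℕ λ k → Σ ℕ λ j → j ℕ.≤ suc k × ((a ≡ + j × c ≡ -[1+ k ]) ⊎ (a ≡ ℤ.- (+ j) × c ≡ + suc k))

InfInUnit→UnitRatio : ∀ γ → InfInUnit γ → UnitRatio (a γ) (c γ)
InfInUnit→UnitRatio (mat a b (+ zero) d) (q , () , _)
InfInUnit→UnitRatio (mat a b (+ suc k) d) (q , refl , -1≤ , ≤0) with frac-in-[-1,0] a k -1≤ ≤0
... | j , j≤ , a≡ = k , j , j≤ , inj₂ (a≡ , refl)
InfInUnit→UnitRatio (mat a b -[1+ k ] d) (q , refl , -1≤ , ≤0) with frac-in-[-1,0] (ℤ.- a) k -1≤ ≤0
... | j , j≤ , -a≡ = k , j , j≤ , inj₁ (ℤP.neg-injective -a≡ , refl)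

UnitRatio→InfInUnit : ∀ γ → UnitRatio (a γ) (c γ) → InfInUnit γ
UnitRatio→InfInUnit (mat _ b _ d) (k , j , j≤ , inj₁ (refl , refl)) = _ , refl , frac-in-[-1,0]⁻ j k j≤
UnitRatio→InfInUnit (mat _ b _ d) (k , j , j≤ , inj₂ (refl , refl)) = _ , refl , frac-in-[-1,0]⁻ j k j≤

atInf-integer : ∀ γ w → atInf γ ≡ just (ℤ→ℚ w) → a γ ≡ w ℤ.* c γ
atInf-integer (mat a b (+ zero) d) w ()
atInf-integer (mat a b (+ suc k) d) w e =
  trans (sym (ℤP.*-identityʳ a)) (frac-≡ a k w 0 (just-injective e))
atInf-integer (mat a b -[1+ k ] d) w e = begin
  a                        ≡⟨ sym (ℤP.neg-involutive a) ⟩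
  ℤ.- (ℤ.- a)              ≡⟨ cong ℤ.-_ (sym (ℤP.*-identityʳ (ℤ.- a))) ⟩
  ℤ.- (ℤ.- a ℤ.* + 1)      ≡⟨ cong ℤ.-_ (frac-≡ (ℤ.- a) k w 0 (just-injective e)) ⟩
  ℤ.- (w ℤ.* + suc k)      ≡⟨ ℤP.neg-distribʳ-* w (+ suc k) ⟩
  w ℤ.* -[1+ k ]           ∎
  where open ≡-Reasoning

atInf-integer⁻ : ∀ γ w → c γ ≢ + 0 → a γ ≡ w ℤ.* c γ → atInf γ ≡ just (ℤ→ℚ w)
atInf-integer⁻ (mat a b (+ zero) d) w c≢0 _ = ⊥-elim (c≢0 refl)
atInf-integer⁻ (mat a b (+ suc k) d) w _ a≡ =
  cong just (frac-≡⁻ a k w 0 (trans (ℤP.*-identityʳ a) a≡))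
atInf-integer⁻ (mat a b -[1+ k ] d) w _ a≡ = cong just (frac-≡⁻ (ℤ.- a) k w 0 (begin
  ℤ.- a ℤ.* + 1                ≡⟨ ℤP.*-identityʳ (ℤ.- a) ⟩
  ℤ.- a                        ≡⟨ cong ℤ.-_ a≡ ⟩
  ℤ.- (w ℤ.* -[1+ k ])         ≡⟨ ℤP.neg-distribʳ-* w -[1+ k ] ⟩
  w ℤ.* + suc k                ∎))
  where open ≡-Reasoning

atInf-neg : ∀ γ → atInf (negM γ) ≡ atInf γ
atInf-neg (mat a b (+ zero) d) = refl
atInf-neg (mat a b (+ suc k) d) = cong (λ z → just (z / suc k)) (ℤP.neg-involutive a)
atInf-neg (mat a b -[1+ k ] d) = refl

ℤ-division : ∀ k r M s → suc k ≡ r ℕ.+ suc M ℕ.* s → -[1+ k ] ℤ.+ + suc M ℤ.* + s ≡ ℤ.- (+ r)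
ℤ-division k r M s k+1≡ = begin
  ℤ.- (+ suc k) ℤ.+ + suc M ℤ.* + s                  ≡⟨ cong (λ n → ℤ.- (+ n) ℤ.+ + suc M ℤ.* + s) k+1≡ ⟩
  ℤ.- (+ (r ℕ.+ suc M ℕ.* s)) ℤ.+ + suc M ℤ.* + s    ≡⟨ cong (λ z → ℤ.- z ℤ.+ + suc M ℤ.* + s) (ℤP.pos-+ r (suc M ℕ.* s)) ⟩
  ℤ.- (+ r ℤ.+ + (suc M ℕ.* s)) ℤ.+ + suc M ℤ.* + s  ≡⟨ cong (λ z → ℤ.- (+ r ℤ.+ z) ℤ.+ + suc M ℤ.* + s) (ℤP.pos-* (suc M) s) ⟩
  ℤ.- (+ r ℤ.+ + suc M ℤ.* + s) ℤ.+ + suc M ℤ.* + s  ≡⟨ ring (+ r) (+ suc M ℤ.* + s) ⟩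
  ℤ.- (+ r) ∎
  where
  open ≡-Reasoning
  ring : ∀ r t → ℤ.- (r ℤ.+ t) ℤ.+ t ≡ ℤ.- r
  ring = solve-∀

size-decreases : ∀ {k j0 j′ N} → j′ ℕ.< suc k → k ℕ.+ suc j0 ℕ.≤ suc N → j0 ℕ.+ j′ ℕ.≤ N
size-decreases {k} {j0} {j′} {N} j′<k+1 size≤ = begin
  j0 ℕ.+ j′ ≤⟨ ℕP.+-monoʳ-≤ j0 (ℕ.s≤s⁻¹ j′<k+1) ⟩
  j0 ℕ.+ k  ≡⟨ ℕP.+-comm j0 k ⟩
  k ℕ.+ j0  ≤⟨ ℕ.s≤s⁻¹ (subst (ℕ._≤ suc N) (ℕP.+-suc k j0) size≤) ⟩
  N         ∎
  where open ℕP.≤-Reasoning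

-- Let h have first column
-- (j0+1, −(k+1)) with j0+1 ≤ k+1 and determinant δ = ±1, excluding
-- j0 = k with δ = −1.  Then the parent of h for a multiplier M+1 ≥ 1 has
-- first column (−j′, ...) with j′ = (k+1) − (M+1)(j0+1): M+1 is the
-- quotient of k+1 by j0+1 and j′ the remainder, except that a zero
-- remainder with δ = −1 is replaced by the quotient minus one and j′ = j0+1.
record Multiplier (k j0 : ℕ) (δ : ℤ) : Set where
  field
    M j′   : ℕ
    split  : -[1+ k ] ℤ.+ + suc M ℤ.* + suc j0 ≡ ℤ.- (+ j′)
    j′≤    : j′ ℕ.≤ suc j0
    j′<    : j′ ℕ.< suc k
    notW₁′ : ¬ (j′ ≡ 0 × δ ≡ -[1+ 0 ])
    notW₂′ : ¬ (j′ ≡ suc j0 × δ ≡ + 1)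

multiplier : ∀ k j0 δ → suc j0 ℕ.≤ suc k → ¬ (suc j0 ≡ suc k × δ ≡ -[1+ 0 ]) → Multiplier k j0 δ
multiplier k j0 δ j≤ notW₂ = divide (suc k ℕD./ suc j0) (ℕD.m≡m%n+[m/n]*n (suc k) (suc j0))
  where
  r : ℕ
  r = suc k ℕD.% suc j0
  r< : r ℕ.< suc j0
  r< = ℕD.m%n<n (suc k) (suc j0)
  divide : ∀ q → suc k ≡ r ℕ.+ q ℕ.* suc j0 → Multiplier k j0 δ
  divide zero k+1≡ = ⊥-elim (ℕP.<⇒≱ r< (subst (suc j0 ℕ.≤_) (trans k+1≡ (ℕP.+-identityʳ r)) j≤))
  divide (suc M) k+1≡ with (r ℕ.≟ 0) ×-dec (δ ℤ.≟ -[1+ 0 ])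
  ... | no excluded = record
    { M = M ; j′ = r ; split = ℤ-division k r M (suc j0) k+1≡ ; j′≤ = ℕP.<⇒≤ r<
    ; j′< = ℕP.<-≤-trans r< j≤ ; notW₁′ = excluded ; notW₂′ = λ { (r≡ , _) → ℕP.<-irrefl r≡ r< } }
  ... | yes (r≡0 , δ≡-1) = shifted M (subst (λ r → suc k ≡ r ℕ.+ suc M ℕ.* suc j0) r≡0 k+1≡)
    where
    shifted : ∀ M → suc k ≡ suc M ℕ.* suc j0 → Multiplier k j0 δ
    shifted zero k+1≡ = ⊥-elim (notW₂ (sym (trans k+1≡ (ℕP.+-identityʳ (suc j0))) , δ≡-1))
    shifted (suc M) k+1≡ = record
      { M = M ; j′ = suc j0 ; split = ℤ-division k (suc j0) M (suc j0) k+1≡ ; j′≤ = ℕP.≤-refl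
      ; j′< = subst (suc j0 ℕ.<_) (sym k+1≡) (ℕP.m<m+n (suc j0) (ℕ.s≤s ℕ.z≤n))
      ; notW₁′ = λ { (() , _) } ; notW₂′ = λ { (_ , δ≡1) → -1≢1 (trans (sym δ≡-1) δ≡1) } }

pos+pos : ∀ u v → 0ℚ ℚ.< u → 0ℚ ℚ.< v → 0ℚ ℚ.< u ℚ.+ v
pos+pos u v pu pv = ℚP.<-respˡ-≡ (ℚP.+-identityˡ 0ℚ) (ℚP.+-mono-< pu pv)

pos*pos : ∀ u v → 0ℚ ℚ.< u → 0ℚ ℚ.< v → 0ℚ ℚ.< u ℚ.* v
pos*pos u v pu pv = ℚP.positive⁻¹ (u ℚ.* v) {{ℚP.pos*pos⇒pos u {{ℚ.positive pu}} v {{ℚ.positive pv}}}}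

neg*neg : ∀ u v → u ℚ.< 0ℚ → v ℚ.< 0ℚ → 0ℚ ℚ.< u ℚ.* v
neg*neg u v nu nv = ℚP.positive⁻¹ (u ℚ.* v) {{ℚP.neg*neg⇒pos u {{ℚ.negative nu}} v {{ℚ.negative nv}}}}

<⇒pos-diff : ∀ t u → t ℚ.< u → 0ℚ ℚ.< u ℚ.- t
<⇒pos-diff t u lt = ℚP.<-respˡ-≡ (ℚP.+-inverseʳ t) (ℚP.+-monoˡ-< (ℚ.- t) lt)

<⇒neg-diff : ∀ t u → u ℚ.< t → u ℚ.- t ℚ.< 0ℚ
<⇒neg-diff t u lt = ℚP.<-respʳ-≡ (ℚP.+-inverseʳ t) (ℚP.+-monoˡ-< (ℚ.- t) lt)

constant : ∀ β t → 0ℚ ℚ.* t ℚ.+ β ≡ β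
constant β t = trans (cong (ℚ._+ β) (ℚP.*-zeroˡ t)) (ℚP.+-identityˡ β)

affine-convex : ∀ α β r s t → 0ℚ ℚ.< α ℚ.* r ℚ.+ β → 0ℚ ℚ.< α ℚ.* s ℚ.+ β →
                r ℚ.≤ t → t ℚ.≤ s → 0ℚ ℚ.< α ℚ.* t ℚ.+ β
affine-convex α β r s t pr ps r≤t t≤s with ℚP.≤-total 0ℚ α
... | inj₁ 0≤α = ℚP.<-≤-trans pr (ℚP.+-monoˡ-≤ β (ℚP.*-monoˡ-≤-nonNeg α {{ℚ.nonNegative 0≤α}} r≤t))
... | inj₂ α≤0 = ℚP.<-≤-trans ps (ℚP.+-monoˡ-≤ β (ℚP.*-monoˡ-≤-nonPos α {{ℚ.nonPositive α≤0}} t≤s))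

module Sign (x : Irrational) where

  below<above : ∀ r s → below x r ≡ true → below x s ≡ false → r ℚ.< s
  below<above r s br bs = ℚP.≰⇒> λ s≤r → true≢false (trans (sym (down x s r s≤r br)) bs)
    where
    true≢false : true ≢ false
    true≢false ()

  Pos-left : ∀ {α β} (P : Pos x α β) t → below x t ≡ true → proj₁ P ℚ.≤ t → 0ℚ ℚ.< α ℚ.* t ℚ.+ β
  Pos-left {α} {β} (r , s , _ , bs , pr , ps) t bt r≤t =
    affine-convex α β r s t pr ps r≤t (ℚP.<⇒≤ (below<above t s bt bs))

  Pos-right : ∀ {α β} (P : Pos x α β) t → below x t ≡ false → t ℚ.≤ proj₁ (proj₂ P) → 0ℚ ℚ.< α ℚ.* t ℚ.+ β
  Pos-right {α} {β} (r , s , br , _ , pr , ps) t bt t≤s =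
    affine-convex α β r s t pr ps (ℚP.<⇒≤ (below<above r t br bt)) t≤s

  -- Positivity is closed under addition: shrink both intervals to their
  -- intersection.
  Pos-+ : ∀ {α β α′ β′} → Pos x α β → Pos x α′ β′ → Pos x (α ℚ.+ α′) (β ℚ.+ β′)
  Pos-+ {α} {β} {α′} {β′} P@(r , s , br , bs , _) P′@(r′ , s′ , br′ , bs′ , _) =
    let (t , bt , pt) = left ; (u , bu , pu) = right in t , u , bt , bu , pt , pu
    where
    PosAt : ℚ → Set
    PosAt t = 0ℚ ℚ.< (α ℚ.+ α′) ℚ.* t ℚ.+ (β ℚ.+ β′)
    both : ∀ t → 0ℚ ℚ.< α ℚ.* t ℚ.+ β → 0ℚ ℚ.< α′ ℚ.* t ℚ.+ β′ → PosAt t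
    both t p p′ = subst (0ℚ ℚ.<_) (sym (split α β α′ β′ t)) (pos+pos _ _ p p′)
      where
      open +-*-Solver
      split : ∀ α β α′ β′ t → (α ℚ.+ α′) ℚ.* t ℚ.+ (β ℚ.+ β′) ≡ (α ℚ.* t ℚ.+ β) ℚ.+ (α′ ℚ.* t ℚ.+ β′)
      split = solve 5 (λ α β α′ β′ t → (α :+ α′) :* t :+ (β :+ β′) := (α :* t :+ β) :+ (α′ :* t :+ β′)) refl
    left : Σ ℚ λ t → below x t ≡ true × PosAt t
    left with ℚP.≤-total r r′
    ... | inj₁ r≤r′ = r′ , br′ , both r′ (Pos-left {α} {β} P r′ br′ r≤r′) (Pos-left {α′} {β′} P′ r′ br′ ℚP.≤-refl)
    ... | inj₂ r′≤r = r , br , both r (Pos-left {α} {β} P r br ℚP.≤-refl) (Pos-left {α′} {β′} P′ r br r′≤r)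
    right : Σ ℚ λ t → below x t ≡ false × PosAt t
    right with ℚP.≤-total s s′
    ... | inj₁ s≤s′ = s , bs , both s (Pos-right {α} {β} P s bs ℚP.≤-refl) (Pos-right {α′} {β′} P′ s bs s≤s′)
    ... | inj₂ s′≤s = s′ , bs′ , both s′ (Pos-right {α} {β} P s′ bs′ s′≤s) (Pos-right {α′} {β′} P′ s′ bs′ ℚP.≤-refl)

  Pos-const : ∀ {β} → Pos x 0ℚ β → 0ℚ ℚ.< β
  Pos-const {β} (r , _ , _ , _ , pr , _) = subst (0ℚ ℚ.<_) (constant β r) pr

  Pos-const⁻ : ∀ {β} → 0ℚ ℚ.< β → Pos x 0ℚ β
  Pos-const⁻ {β} p with inhabL x | inhabU x
  ... | r , br | s , bs = r , s , br , bs , subst (0ℚ ℚ.<_) (sym (constant β r)) p , subst (0ℚ ℚ.<_) (sym (constant β s)) p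

  -- A non-constant affine function has a sign at the irrational x: x lies
  -- strictly on one side of the root t = −β/α, and on that side the
  -- function α u + β = α (u − t) has constant sign.
  Pos-dichotomy : ∀ {α β} → α ≢ 0ℚ → Pos x α β ⊎ Pos x (ℚ.- α) (ℚ.- β)
  Pos-dichotomy {α} {β} α≢0 = decide
    where
    instance
      α-nonZero : ℚ.NonZero α
      α-nonZero = ℚ.≢-nonZero α≢0
    t : ℚ
    t = (ℚ.- β) ℚ.* ℚ.1/ α
    sign : α ℚ.< 0ℚ ⊎ 0ℚ ℚ.< α
    sign with ℚP.<-cmp α 0ℚ
    ... | tri< α<0 _ _ = inj₁ α<0
    ... | tri≈ _ α≡0 _ = ⊥-elim (α≢0 α≡0)
    ... | tri> _ _ 0<α = inj₂ 0<α
    open +-*-Solver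
    root : α ℚ.* t ℚ.+ β ≡ 0ℚ
    root = begin
      α ℚ.* ((ℚ.- β) ℚ.* ℚ.1/ α) ℚ.+ β ≡⟨ reassoc α β (ℚ.1/ α) ⟩
      (ℚ.- β) ℚ.* (α ℚ.* ℚ.1/ α) ℚ.+ β ≡⟨ cong (λ w → (ℚ.- β) ℚ.* w ℚ.+ β) (ℚP.*-inverseʳ α) ⟩
      (ℚ.- β) ℚ.* 1ℚ ℚ.+ β             ≡⟨ cong (ℚ._+ β) (ℚP.*-identityʳ (ℚ.- β)) ⟩
      ℚ.- β ℚ.+ β                      ≡⟨ ℚP.+-inverseˡ β ⟩
      0ℚ ∎
      where
      open ≡-Reasoning
      reassoc : ∀ α β i → α ℚ.* ((ℚ.- β) ℚ.* i) ℚ.+ β ≡ (ℚ.- β) ℚ.* (α ℚ.* i) ℚ.+ β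
      reassoc = solve 3 (λ α β i → α :* ((:- β) :* i) :+ β := (:- β) :* (α :* i) :+ β) refl
    factor : ∀ u → α ℚ.* u ℚ.+ β ≡ α ℚ.* (u ℚ.- t)
    factor u = begin
      α ℚ.* u ℚ.+ β                          ≡⟨ shift α β t u ⟩
      α ℚ.* (u ℚ.- t) ℚ.+ (α ℚ.* t ℚ.+ β)   ≡⟨ cong (α ℚ.* (u ℚ.- t) ℚ.+_) root ⟩
      α ℚ.* (u ℚ.- t) ℚ.+ 0ℚ                ≡⟨ ℚP.+-identityʳ _ ⟩
      α ℚ.* (u ℚ.- t) ∎
      where
      open ≡-Reasoning
      shift : ∀ α β t u → α ℚ.* u ℚ.+ β ≡ α ℚ.* (u ℚ.- t) ℚ.+ (α ℚ.* t ℚ.+ β)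
      shift = solve 4 (λ α β t u → α :* u :+ β := α :* (u :- t) :+ (α :* t :+ β)) refl
    factor⁻ : ∀ u → (ℚ.- α) ℚ.* u ℚ.+ (ℚ.- β) ≡ α ℚ.* (t ℚ.- u)
    factor⁻ u = begin
      (ℚ.- α) ℚ.* u ℚ.+ (ℚ.- β)                 ≡⟨ shift⁻ α β t u ⟩
      α ℚ.* (t ℚ.- u) ℚ.+ ℚ.- (α ℚ.* t ℚ.+ β)   ≡⟨ cong (λ w → α ℚ.* (t ℚ.- u) ℚ.+ ℚ.- w) root ⟩
      α ℚ.* (t ℚ.- u) ℚ.+ ℚ.- 0ℚ                ≡⟨ ℚP.+-identityʳ _ ⟩
      α ℚ.* (t ℚ.- u) ∎
      where
      open ≡-Reasoning
      shift⁻ : ∀ α β t u → (ℚ.- α) ℚ.* u ℚ.+ (ℚ.- β) ≡ α ℚ.* (t ℚ.- u) ℚ.+ ℚ.- (α ℚ.* t ℚ.+ β)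
      shift⁻ = solve 4 (λ α β t u → (:- α) :* u :+ (:- β) := α :* (t :- u) :+ (:- (α :* t :+ β))) refl
    pos-right : 0ℚ ℚ.< α → ∀ u → t ℚ.< u → 0ℚ ℚ.< α ℚ.* u ℚ.+ β
    pos-right 0<α u t<u = subst (0ℚ ℚ.<_) (sym (factor u)) (pos*pos _ _ 0<α (<⇒pos-diff t u t<u))
    pos-left : α ℚ.< 0ℚ → ∀ u → u ℚ.< t → 0ℚ ℚ.< α ℚ.* u ℚ.+ β
    pos-left α<0 u u<t = subst (0ℚ ℚ.<_) (sym (factor u)) (neg*neg _ _ α<0 (<⇒neg-diff t u u<t))
    neg-left : 0ℚ ℚ.< α → ∀ u → u ℚ.< t → 0ℚ ℚ.< (ℚ.- α) ℚ.* u ℚ.+ (ℚ.- β)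
    neg-left 0<α u u<t = subst (0ℚ ℚ.<_) (sym (factor⁻ u)) (pos*pos _ _ 0<α (<⇒pos-diff u t u<t))
    neg-right : α ℚ.< 0ℚ → ∀ u → t ℚ.< u → 0ℚ ℚ.< (ℚ.- α) ℚ.* u ℚ.+ (ℚ.- β)
    neg-right α<0 u t<u = subst (0ℚ ℚ.<_) (sym (factor⁻ u)) (neg*neg _ _ α<0 (<⇒neg-diff u t t<u))
    decide : Pos x α β ⊎ Pos x (ℚ.- α) (ℚ.- β)
    decide with below x t in bt
    ... | true with noMax x t bt | inhabU x
    ...   | r , t<r , br | s , bs with below<above t s bt bs | sign
    ...     | t<s | inj₂ 0<α = inj₁ (r , s , br , bs , pos-right 0<α r t<r , pos-right 0<α s t<s)
    ...     | t<s | inj₁ α<0 = inj₂ (r , s , br , bs , neg-right α<0 r t<r , neg-right α<0 s t<s)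
    decide | false with noMin x t bt | inhabL x
    ...   | s , s<t , bs | r , br with below<above r t br bt | sign
    ...     | r<t | inj₂ 0<α = inj₂ (r , s , br , bs , neg-left 0<α r r<t , neg-left 0<α s s<t)
    ...     | r<t | inj₁ α<0 = inj₁ (r , s , br , bs , pos-left α<0 r r<t , pos-left α<0 s s<t)

  -- p·x + q > 0 for integers p, q.  (A record, so that p and q are
  -- determined by the type and can be inferred.)
  record LinPos (p q : ℤ) : Set where
    constructor linPos
    field pos : Pos x (ℤ→ℚ p) (ℤ→ℚ q)

  toLinPos : ∀ {p q α β} → ℤ→ℚ p ≡ α → ℤ→ℚ q ≡ β → Pos x α β → LinPos p q
  toLinPos refl refl P = linPos P

  fromLinPos : ∀ {p q α β} → ℤ→ℚ p ≡ α → ℤ→ℚ q ≡ β → LinPos p q → Pos x α β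
  fromLinPos refl refl (linPos P) = P

  LinPos-cong : ∀ {p q p′ q′} → p ≡ p′ → q ≡ q′ → LinPos p q → LinPos p′ q′
  LinPos-cong refl refl l = l

  LinPos-+ : ∀ {p q p′ q′} → LinPos p q → LinPos p′ q′ → LinPos (p ℤ.+ p′) (q ℤ.+ q′)
  LinPos-+ {p} {q} {p′} {q′} (linPos P) (linPos P′) =
    toLinPos (ℤ→ℚ-+ p p′) (ℤ→ℚ-+ q q′) (Pos-+ {ℤ→ℚ p} {ℤ→ℚ q} {ℤ→ℚ p′} {ℤ→ℚ q′} P P′)

  LinPos-const : ∀ {q} → LinPos (+ 0) q → + 0 ℤ.< q
  LinPos-const (linPos P) = ℤ→ℚ-cancel-< (Pos-const P)

  LinPos-const⁻ : ∀ {q} → + 0 ℤ.< q → LinPos (+ 0) q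
  LinPos-const⁻ lt = linPos (Pos-const⁻ (ℤ→ℚ-mono-< lt))

  LinPos-zero : ¬ LinPos (+ 0) (+ 0)
  LinPos-zero l = ℤP.<-irrefl refl (LinPos-const l)

  LinPos-dichotomy : ∀ {p q} → (p ≢ + 0 ⊎ q ≢ + 0) → LinPos p q ⊎ LinPos (ℤ.- p) (ℤ.- q)
  LinPos-dichotomy {p} {q} (inj₁ p≢0) with Pos-dichotomy {ℤ→ℚ p} {ℤ→ℚ q} (λ e → p≢0 (ℤ→ℚ-zero e))
  ... | inj₁ P = inj₁ (linPos P)
  ... | inj₂ P = inj₂ (toLinPos (ℤ→ℚ-neg p) (ℤ→ℚ-neg q) P)
  LinPos-dichotomy {p} {q} (inj₂ q≢0) with p ℤ.≟ + 0
  ... | no p≢0 = LinPos-dichotomy (inj₁ p≢0)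
  ... | yes refl with ℤP.<-cmp q (+ 0)
  ...   | tri< q<0 _ _ = inj₂ (LinPos-const⁻ (ℤP.neg-mono-< q<0))
  ...   | tri≈ _ q≡0 _ = ⊥-elim (q≢0 q≡0)
  ...   | tri> _ _ 0<q = inj₁ (LinPos-const⁻ 0<q)

  LinPos-exclusive : ∀ {p q} → LinPos p q → LinPos (ℤ.- p) (ℤ.- q) → ⊥
  LinPos-exclusive {p} {q} l l′ = LinPos-zero (LinPos-cong (ℤP.+-inverseʳ p) (ℤP.+-inverseʳ q) (LinPos-+ l l′))

  -- (u₁ x + u₂) / (v₁ x + v₂) > 0: both linear forms have the same sign at x.
  SameSign : ℤ → ℤ → ℤ → ℤ → Set
  SameSign u₁ u₂ v₁ v₂ = (LinPos u₁ u₂ × LinPos v₁ v₂) ⊎ (LinPos (ℤ.- u₁) (ℤ.- u₂) × LinPos (ℤ.- v₁) (ℤ.- v₂))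

  SameSign-cong : ∀ {u₁ u₂ v₁ v₂ u₁′ u₂′ v₁′ v₂′} → u₁ ≡ u₁′ → u₂ ≡ u₂′ → v₁ ≡ v₁′ → v₂ ≡ v₂′ →
                  SameSign u₁ u₂ v₁ v₂ → SameSign u₁′ u₂′ v₁′ v₂′
  SameSign-cong refl refl refl refl s = s

  SameSign-sym : ∀ {u₁ u₂ v₁ v₂} → SameSign u₁ u₂ v₁ v₂ → SameSign v₁ v₂ u₁ u₂
  SameSign-sym (inj₁ (l , l′)) = inj₁ (l′ , l)
  SameSign-sym (inj₂ (l , l′)) = inj₂ (l′ , l)

  SameSign-trans : ∀ {u₁ u₂ v₁ v₂ w₁ w₂} → SameSign u₁ u₂ v₁ v₂ → SameSign v₁ v₂ w₁ w₂ → SameSign u₁ u₂ w₁ w₂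
  SameSign-trans (inj₁ (l , _)) (inj₁ (_ , m)) = inj₁ (l , m)
  SameSign-trans (inj₁ (_ , l)) (inj₂ (m , _)) = ⊥-elim (LinPos-exclusive l m)
  SameSign-trans (inj₂ (_ , l)) (inj₁ (m , _)) = ⊥-elim (LinPos-exclusive m l)
  SameSign-trans (inj₂ (l , _)) (inj₂ (_ , m)) = inj₂ (l , m)

  SameSign-self : ∀ {u₁ u₂ v₁ v₂} → SameSign u₁ u₂ v₁ v₂ → SameSign v₁ v₂ v₁ v₂
  SameSign-self s = SameSign-trans (SameSign-sym s) s

  SameSign-neg : ∀ {u₁ u₂ v₁ v₂} → SameSign u₁ u₂ v₁ v₂ → SameSign (ℤ.- u₁) (ℤ.- u₂) (ℤ.- v₁) (ℤ.- v₂)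
  SameSign-neg (inj₁ (l , m)) = inj₂ (LinPos-cong (sym (ℤP.neg-involutive _)) (sym (ℤP.neg-involutive _)) l ,
                                      LinPos-cong (sym (ℤP.neg-involutive _)) (sym (ℤP.neg-involutive _)) m)
  SameSign-neg (inj₂ (l , m)) = inj₁ (l , m)

  SameSign-zero : ∀ {v₁ v₂} → ¬ SameSign (+ 0) (+ 0) v₁ v₂
  SameSign-zero (inj₁ (l , _)) = LinPos-zero l
  SameSign-zero (inj₂ (l , _)) = LinPos-zero l

  SameSign-+ : ∀ {u₁ u₂ w₁ w₂ v₁ v₂} → SameSign u₁ u₂ v₁ v₂ → SameSign w₁ w₂ v₁ v₂ →
               SameSign (u₁ ℤ.+ w₁) (u₂ ℤ.+ w₂) v₁ v₂
  SameSign-+ (inj₁ (l , m)) (inj₁ (l′ , _)) = inj₁ (LinPos-+ l l′ , m)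
  SameSign-+ (inj₁ (_ , m)) (inj₂ (_ , m′)) = ⊥-elim (LinPos-exclusive m m′)
  SameSign-+ (inj₂ (_ , m)) (inj₁ (_ , m′)) = ⊥-elim (LinPos-exclusive m′ m)
  SameSign-+ {u₁} {u₂} {w₁} {w₂} (inj₂ (l , m)) (inj₂ (l′ , _)) =
    inj₂ (LinPos-cong (sym (ℤP.neg-distrib-+ u₁ w₁)) (sym (ℤP.neg-distrib-+ u₂ w₂)) (LinPos-+ l l′) , m)

  SameSign-+-multiple : ∀ (p : ℕ) {u₁ u₂ v₁ v₂} → SameSign u₁ u₂ v₁ v₂ →
                        SameSign (u₁ ℤ.+ + p ℤ.* v₁) (u₂ ℤ.+ + p ℤ.* v₂) v₁ v₂
  SameSign-+-multiple zero {u₁} {u₂} {v₁} {v₂} s = SameSign-cong (sym (ring u₁ v₁)) (sym (ring u₂ v₂)) refl refl s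
    where
    ring : ∀ u v → u ℤ.+ + 0 ℤ.* v ≡ u
    ring = solve-∀
  SameSign-+-multiple (suc p) {u₁} {u₂} {v₁} {v₂} s =
    SameSign-cong (ring u₁ (+ p) v₁) (ring u₂ (+ p) v₂) refl refl (SameSign-+ (SameSign-+-multiple p s) (SameSign-self s))
    where
    ring : ∀ u p v → u ℤ.+ p ℤ.* v ℤ.+ v ≡ u ℤ.+ (+ 1 ℤ.+ p) ℤ.* v
    ring = solve-∀

  -- g(x) > n and g(x) < n for a matrix g and an integer n, as sign conditions.
  Above : M2 → ℤ → Set
  Above g n = SameSign (a g ℤ.- n ℤ.* c g) (b g ℤ.- n ℤ.* d g) (c g) (d g)

  Under : M2 → ℤ → Set
  Under g n = SameSign (n ℤ.* c g ℤ.- a g) (n ℤ.* d g ℤ.- b g) (c g) (d g)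

  ActGt→Above : ∀ g n → ActGt x g (ℤ→ℚ n) → Above g n
  ActGt→Above (mat a b c d) n (inj₁ (P , Q)) =
    inj₁ (toLinPos (ℤ→ℚ-sub-mul a n c) (ℤ→ℚ-sub-mul b n d) P , linPos Q)
  ActGt→Above (mat a b c d) n (inj₂ (P , Q)) =
    inj₂ (toLinPos (trans (cong ℤ→ℚ (ℤ-neg-sub a (n ℤ.* c))) (ℤ→ℚ-mul-sub a n c))
                   (trans (cong ℤ→ℚ (ℤ-neg-sub b (n ℤ.* d))) (ℤ→ℚ-mul-sub b n d)) P ,
          toLinPos (ℤ→ℚ-neg c) (ℤ→ℚ-neg d) Q)

  Above→ActGt : ∀ g n → Above g n → ActGt x g (ℤ→ℚ n)
  Above→ActGt (mat a b c d) n (inj₁ (l , linPos Q)) =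
    inj₁ (fromLinPos (ℤ→ℚ-sub-mul a n c) (ℤ→ℚ-sub-mul b n d) l , Q)
  Above→ActGt (mat a b c d) n (inj₂ (l , m)) =
    inj₂ (fromLinPos (trans (cong ℤ→ℚ (ℤ-neg-sub a (n ℤ.* c))) (ℤ→ℚ-mul-sub a n c))
                     (trans (cong ℤ→ℚ (ℤ-neg-sub b (n ℤ.* d))) (ℤ→ℚ-mul-sub b n d)) l ,
          fromLinPos (ℤ→ℚ-neg c) (ℤ→ℚ-neg d) m)

  ActLt→Under : ∀ g n → ActLt x g (ℤ→ℚ n) → Under g n
  ActLt→Under (mat a b c d) n (inj₁ (P , Q)) =
    inj₁ (toLinPos (ℤ→ℚ-mul-sub a n c) (ℤ→ℚ-mul-sub b n d) P , linPos Q)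
  ActLt→Under (mat a b c d) n (inj₂ (P , Q)) =
    inj₂ (toLinPos (trans (cong ℤ→ℚ (ℤ-neg-sub (n ℤ.* c) a)) (ℤ→ℚ-sub-mul a n c))
                   (trans (cong ℤ→ℚ (ℤ-neg-sub (n ℤ.* d) b)) (ℤ→ℚ-sub-mul b n d)) P ,
          toLinPos (ℤ→ℚ-neg c) (ℤ→ℚ-neg d) Q)

  Under→ActLt : ∀ g n → Under g n → ActLt x g (ℤ→ℚ n)
  Under→ActLt (mat a b c d) n (inj₁ (l , linPos Q)) =
    inj₁ (fromLinPos (ℤ→ℚ-mul-sub a n c) (ℤ→ℚ-mul-sub b n d) l , Q)
  Under→ActLt (mat a b c d) n (inj₂ (l , m)) =
    inj₂ (fromLinPos (trans (cong ℤ→ℚ (ℤ-neg-sub (n ℤ.* c) a)) (ℤ→ℚ-sub-mul a n c))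
                     (trans (cong ℤ→ℚ (ℤ-neg-sub (n ℤ.* d) b)) (ℤ→ℚ-sub-mul b n d)) l ,
          fromLinPos (ℤ→ℚ-neg c) (ℤ→ℚ-neg d) m)

  Above-neg : ∀ g n → Above g n → Above (negM g) n
  Above-neg (mat a b c d) n s = SameSign-cong (ring a n c) (ring b n d) refl refl (SameSign-neg s)
    where
    ring : ∀ a n c → ℤ.- (a ℤ.- n ℤ.* c) ≡ ℤ.- a ℤ.- n ℤ.* ℤ.- c
    ring = solve-∀

  Under-neg : ∀ g n → Under g n → Under (negM g) n
  Under-neg (mat a b c d) n s = SameSign-cong (ring a n c) (ring b n d) refl refl (SameSign-neg s)
    where
    ring : ∀ a n c → ℤ.- (n ℤ.* c ℤ.- a) ≡ n ℤ.* ℤ.- c ℤ.- ℤ.- a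
    ring = solve-∀

module Reduction (x : Irrational) where
  open Sign x

  record Reduced (h : M2) : Set where
    field
      k j        : ℕ
      a≡j        : a h ≡ + j
      c≡-k-1     : c h ≡ -[1+ k ]
      j≤k+1      : j ℕ.≤ suc k
      above1     : Above h (+ 1)
      unimodular : Unimodular h
      notW₁      : ¬ (j ≡ 0 × det h ≡ + 1)
      notW₂      : ¬ (j ≡ suc k × det h ≡ -[1+ 0 ])

  -- If n < h(x) < n + 1 then (ε T^{-n} h)(x) = 1 / (h(x) − n) > 1.
  Above-step : ∀ h n → Above h n → Under h (n ℤ.+ + 1) → Above (step n h) (+ 1)
  Above-step (mat a b c d) n gt lt = SameSign-cong (ring n a c) (ring n b d) refl refl (SameSign-trans lt (SameSign-sym gt))
    where
    ring : ∀ n a c → (n ℤ.+ + 1) ℤ.* c ℤ.- a ≡ c ℤ.- + 1 ℤ.* (a ℤ.- n ℤ.* c)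
    ring = solve-∀

  digit-positive : ∀ h n → Above h (+ 1) → Under h (n ℤ.+ + 1) → Σ ℕ λ m → n ≡ + suc m
  digit-positive (mat a b c d) n gt1 lt = positive n (SameSign-cong (ring n a c) (ring n b d) refl refl (SameSign-+ gt1 lt))
    where
    ring : ∀ n a c → (a ℤ.- + 1 ℤ.* c) ℤ.+ ((n ℤ.+ + 1) ℤ.* c ℤ.- a) ≡ n ℤ.* c
    ring = solve-∀
    cancel : ∀ s c → ℤ.- s ℤ.* c ℤ.+ s ℤ.* c ≡ + 0
    cancel = solve-∀
    -- n·(c x + d) has the sign of c x + d only for n > 0
    positive : ∀ n → SameSign (n ℤ.* c) (n ℤ.* d) c d → Σ ℕ λ m → n ≡ + suc m
    positive (+ suc m) _ = m , refl
    positive (+ zero) s = ⊥-elim (SameSign-zero (SameSign-cong (ℤP.*-zeroˡ c) (ℤP.*-zeroˡ d) refl refl s))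
    positive -[1+ m ] s = ⊥-elim (SameSign-zero
      (SameSign-cong (cancel (+ suc m) c) (cancel (+ suc m) d) refl refl (SameSign-+-multiple (suc m) s)))

  -- One continued-fraction step preserves reducedness up to sign: with
  -- n = m+1 > 0, the matrix −ε T^{-n} h has first column
  -- (k+1, −(j + n(k+1))) and determinant −det h.
  Reduced-step : ∀ {h} → Reduced h → ∀ n → Above h n → Under h (n ℤ.+ + 1) → Reduced (negM (step n h))
  Reduced-step {h} R n gt lt with digit-positive h n (Reduced.above1 R) lt
  ... | m , refl = record
    { k          = K
    ; j          = suc k
    ; a≡j        = cong ℤ.-_ c≡-k-1
    ; c≡-k-1     = trans (cong₂ (λ u v → ℤ.- (u ℤ.- + suc m ℤ.* v)) a≡j c≡-k-1) new-c
    ; j≤k+1      = ℕ.s≤s (ℕP.≤-trans (ℕP.m≤m+n k (m ℕ.* suc k)) (ℕP.m≤n+m _ j))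
    ; above1     = Above-neg (step (+ suc m) h) (+ 1) (Above-step h (+ suc m) gt lt)
    ; unimodular = Unimodular-neg (step (+ suc m) h) (Unimodular-step (+ suc m) h unimodular)
    ; notW₁      = λ { (() , _) }
    ; notW₂      = λ { (k≡K , det≡-1) → notW₁ (j≡0 (ℕP.suc-injective k≡K) ,
                         ℤP.neg-injective (trans (sym (det-step (+ suc m) h)) (trans (sym (det-neg (step (+ suc m) h))) det≡-1))) }
    }
    where
    open Reduced R
    K : ℕ
    K = j ℕ.+ (k ℕ.+ m ℕ.* suc k)
    new-c : ℤ.- (+ j ℤ.- + suc m ℤ.* -[1+ k ]) ≡ -[1+ K ]
    new-c = begin
      ℤ.- (+ j ℤ.- + suc m ℤ.* ℤ.- (+ suc k)) ≡⟨ ring (+ j) (+ suc m) (+ suc k) ⟩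
      ℤ.- (+ j ℤ.+ + suc m ℤ.* + suc k)        ≡⟨ cong (λ z → ℤ.- (+ j ℤ.+ z)) (sym (ℤP.pos-* (suc m) (suc k))) ⟩
      ℤ.- (+ j ℤ.+ + (suc m ℕ.* suc k))        ≡⟨ cong ℤ.-_ (sym (ℤP.pos-+ j (suc m ℕ.* suc k))) ⟩
      ℤ.- (+ (j ℕ.+ suc m ℕ.* suc k))          ≡⟨ cong (λ z → ℤ.- (+ z)) (ℕP.+-suc j (k ℕ.+ m ℕ.* suc k)) ⟩
      -[1+ K ] ∎
      where
      open ≡-Reasoning
      ring : ∀ a n s → ℤ.- (a ℤ.- n ℤ.* ℤ.- s) ≡ ℤ.- (a ℤ.+ n ℤ.* s)
      ring = solve-∀
    absorb : ∀ j X → k ≡ j ℕ.+ (k ℕ.+ X) → j ≡ 0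
    absorb zero _ _ = refl
    absorb (suc i) X e = ⊥-elim (ℕP.<-irrefl e (ℕ.s≤s (ℕP.≤-trans (ℕP.m≤m+n k X) (ℕP.m≤n+m _ i))))
    j≡0 : k ≡ K → j ≡ 0
    j≡0 = absorb j (m ℕ.* suc k)

  Reduced-first : ∀ n → Above Id n → Under Id (n ℤ.+ + 1) → Reduced (negM (step n Id))
  Reduced-first n gt lt = record
    { k          = 0
    ; j          = 0
    ; a≡j        = refl
    ; c≡-k-1     = ring n
    ; j≤k+1      = ℕ.z≤n
    ; above1     = Above-neg (step n Id) (+ 1) (Above-step Id n gt lt)
    ; unimodular = Unimodular-neg (step n Id) (Unimodular-step n Id (inj₁ refl))
    ; notW₁      = λ { (_ , det≡1) → -1≢1 (trans (sym (trans (det-neg (step n Id)) (det-step n Id))) det≡1) }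
    ; notW₂      = λ { (() , _) }
    }
    where
    ring : ∀ n → ℤ.- (+ 1 ℤ.- n ℤ.* + 0) ≡ -[1+ 0 ]
    ring = solve-∀

  Reduced±-step : ∀ {g} n → Reduced g ⊎ Reduced (negM g) → Above g n → Under g (n ℤ.+ + 1) →
                  Reduced (step n g) ⊎ Reduced (negM (step n g))
  Reduced±-step n (inj₁ R) gt lt = inj₂ (Reduced-step R n gt lt)
  Reduced±-step {g} n (inj₂ R) gt lt =
    inj₁ (subst Reduced (trans (cong negM (step-neg n g)) (negM-involutive _))
                (Reduced-step R n (Above-neg g n gt) (Under-neg g (n ℤ.+ + 1) lt)))

  CF→Reduced : ∀ {i g} → CF x (suc i) g → Reduced g ⊎ Reduced (negM g)
  CF→Reduced (cfS cf0 n gt lt) =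
    inj₂ (subst (λ g → Reduced (negM g)) (sym (step-≡ n Id))
                (Reduced-first n (ActGt→Above Id n gt) (ActLt→Under Id (n ℤ.+ + 1) lt)))
  CF→Reduced (cfS {g = g} cf@(cfS _ _ _ _) n gt lt) =
    subst (λ g → Reduced g ⊎ Reduced (negM g)) (sym (step-≡ n g))
          (Reduced±-step n (CF→Reduced cf) (ActGt→Above g n gt) (ActLt→Under g (n ℤ.+ + 1) lt))

  InΓx-neg : ∀ g → InΓx x (negM g) → InΓx x g
  InΓx-neg g (i , g′ , cf , inj₁ g′≡) = i , g′ , cf , inj₂ (trans (sym (negM-involutive g)) (cong negM g′≡))
  InΓx-neg g (i , g′ , cf , inj₂ g′≡) =
    i , g′ , cf , inj₁ (trans (sym (negM-involutive g)) (trans (cong negM g′≡) (negM-involutive g′)))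

  CF-step : ∀ {i g′} g n → CF x i g′ → g′ ~ g → Above g n → Under g (n ℤ.+ + 1) →
            ∃ λ g″ → CF x (suc i) g″ × g″ ~ step n g
  CF-step g n cf (inj₁ refl) gt lt =
    _ , cfS cf n (Above→ActGt g n gt) (Under→ActLt g (n ℤ.+ + 1) lt) , inj₁ (sym (step-≡ n g))
  CF-step {g′ = g′} g n cf (inj₂ refl) gt lt =
    _ , cfS cf n (Above→ActGt g′ n (subst (λ h → Above h n) (negM-involutive g′) (Above-neg g n gt)))
                 (Under→ActLt g′ (n ℤ.+ + 1)
                   (subst (λ h → Under h (n ℤ.+ + 1)) (negM-involutive g′) (Under-neg g (n ℤ.+ + 1) lt))) ,
    inj₂ (trans (step-neg n g′) (cong negM (sym (step-≡ n g′))))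

  InΓx-step : ∀ g n → Above g n → Under g (n ℤ.+ + 1) → InΓx x g → InΓx x (step n g)
  InΓx-step g n gt lt (i , g′ , cf , g′~g) = let (g″ , cf′ , ~) = CF-step g n cf g′~g gt lt in suc i , g″ , cf′ , ~

  InΓx-first : ∀ n → Above Id n → Under Id (n ℤ.+ + 1) → InΓx x (step n Id)
  InΓx-first n gt lt = let (g″ , cf′ , ~) = CF-step Id n cf0 (inj₁ refl) gt lt in 0 , g″ , cf′ , ~

  Above-weaken : ∀ g m → Above g (+ suc m) → Above g (+ 1)
  Above-weaken (mat a b c d) m s =
    SameSign-cong (ring a (+ m) c) (ring b (+ m) d) refl refl (SameSign-+-multiple m s)
    where
    ring : ∀ a m c → a ℤ.- (+ 1 ℤ.+ m) ℤ.* c ℤ.+ m ℤ.* c ≡ a ℤ.- + 1 ℤ.* c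
    ring = solve-∀

  Above1⇒positive : ∀ a b c d → Above (mat a b c d) (+ 1) → SameSign a b c d
  Above1⇒positive a b c d s = SameSign-cong (ring a c) (ring b d) refl refl (SameSign-+ s (SameSign-self s))
    where
    ring : ∀ a c → a ℤ.- + 1 ℤ.* c ℤ.+ c ≡ a
    ring = solve-∀

  -- If h(x) > 1 then its parent P for any multiplier M satisfies M < P(x) < M+1,
  -- since P(x) = M + 1/h(x).
  parent-above : ∀ M h → Above h (+ 1) → Above (parent M h) M
  parent-above M (mat a b c d) gt1 =
    SameSign-cong (sym (ring c M a)) (sym (ring d M b)) refl refl (SameSign-sym (Above1⇒positive a b c d gt1))
    where
    ring : ∀ c M a → c ℤ.+ M ℤ.* a ℤ.- M ℤ.* a ≡ c
    ring = solve-∀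

  parent-under : ∀ M h → Above h (+ 1) → Under (parent M h) (M ℤ.+ + 1)
  parent-under M (mat a b c d) gt1 =
    SameSign-cong (ring a c M) (ring b d M) refl refl (SameSign-trans gt1 (SameSign-sym (Above1⇒positive a b c d gt1)))
    where
    ring : ∀ a c M → a ℤ.- + 1 ℤ.* c ≡ (M ℤ.+ + 1) ℤ.* a ℤ.- (c ℤ.+ M ℤ.* a)
    ring = solve-∀

  Reduced-parent : ∀ {h} (R : Reduced h) {j0} → Reduced.j R ≡ suc j0 →
                   (μ : Multiplier (Reduced.k R) j0 (det h)) →
                   Reduced (negM (parent (+ suc (Multiplier.M μ)) h))
  Reduced-parent {h} R {j0} j≡ μ = record
    { k          = j0
    ; j          = j′
    ; a≡j        = begin
        ℤ.- (c h ℤ.+ + suc M ℤ.* a h)               ≡⟨ cong₂ (λ u v → ℤ.- (u ℤ.+ + suc M ℤ.* v)) c≡-k-1 a≡j0+1 ⟩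
        ℤ.- (-[1+ k ] ℤ.+ + suc M ℤ.* + suc j0)     ≡⟨ cong ℤ.-_ split ⟩
        ℤ.- (ℤ.- (+ j′))                            ≡⟨ ℤP.neg-involutive (+ j′) ⟩
        + j′ ∎
    ; c≡-k-1     = cong ℤ.-_ a≡j0+1
    ; j≤k+1      = j′≤
    ; above1     = Above-neg P (+ 1) (Above-weaken P M (parent-above (+ suc M) h above1))
    ; unimodular = subst (λ z → z ≡ + 1 ⊎ z ≡ ℤ.- (+ 1)) (sym (det-parent (+ suc M) h)) (±1-neg unimodular)
    ; notW₁      = λ { (j′≡0 , det≡1) → notW₁′ (j′≡0 , ℤP.neg-injective (trans (sym (det-parent (+ suc M) h)) det≡1)) }
    ; notW₂      = λ { (j′≡ , det≡-1) → notW₂′ (j′≡ , ℤP.neg-injective (trans (sym (det-parent (+ suc M) h)) det≡-1)) }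
    }
    where
    open ≡-Reasoning
    open Reduced R
    open Multiplier μ
    P : M2
    P = parent (+ suc M) h
    a≡j0+1 : a h ≡ + suc j0
    a≡j0+1 = trans a≡j (cong +_ j≡)

  InΓx-parent : ∀ m h → Above h (+ 1) → InΓx x (negM (parent (+ suc m) h)) → InΓx x h
  InΓx-parent m h gt1 inΓ = subst (InΓx x) (step-parent (+ suc m) h)
    (InΓx-step (parent (+ suc m) h) (+ suc m) (parent-above (+ suc m) h gt1) (parent-under (+ suc m) h gt1)
               (InΓx-neg (parent (+ suc m) h) inΓ))

  -- [[0, −1], [−1, d]] with h(x) = 1/(x − d) > 1 is −γ₁ (with n₀ = d).
  InΓx-base : ∀ d → Above (mat (+ 0) -[1+ 0 ] -[1+ 0 ] d) (+ 1) → InΓx x (mat (+ 0) -[1+ 0 ] -[1+ 0 ] d)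
  InΓx-base d (inj₁ (l₁ , l₂)) = ⊥-elim (contra (LinPos-const (LinPos-cong refl (ring d) (LinPos-+ l₁ l₂))))
    where
    ring : ∀ d → -[1+ 0 ] ℤ.- + 1 ℤ.* d ℤ.+ d ≡ -[1+ 0 ]
    ring = solve-∀
    contra : ¬ (+ 0 ℤ.< -[1+ 0 ])
    contra ()
  InΓx-base d (inj₂ (l₁ , l₂)) = InΓx-neg _ (subst (InΓx x) (mat-≡ refl refl (ring₁ d) (ring₂ d))
    (InΓx-first d (inj₁ (LinPos-cong (ring₃ d) (ring₄ d) l₂ , positive))
                  (inj₁ (LinPos-cong (ring₅ d) (ring₆ d) l₁ , positive))))
    where
    positive : LinPos (+ 0) (+ 1)
    positive = LinPos-const⁻ (ℤ.+<+ (ℕ.s≤s ℕ.z≤n))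
    ring₁ : ∀ d → + 1 ℤ.- d ℤ.* + 0 ≡ ℤ.- -[1+ 0 ]
    ring₁ = solve-∀
    ring₂ : ∀ d → + 0 ℤ.- d ℤ.* + 1 ≡ ℤ.- d
    ring₂ = solve-∀
    ring₃ : ∀ d → ℤ.- -[1+ 0 ] ≡ + 1 ℤ.- d ℤ.* + 0
    ring₃ = solve-∀
    ring₄ : ∀ d → ℤ.- d ≡ + 0 ℤ.- d ℤ.* + 1
    ring₄ = solve-∀
    ring₅ : ∀ d → ℤ.- (+ 0 ℤ.- + 1 ℤ.* -[1+ 0 ]) ≡ (d ℤ.+ + 1) ℤ.* + 0 ℤ.- + 1
    ring₅ = solve-∀
    ring₆ : ∀ d → ℤ.- (-[1+ 0 ] ℤ.- + 1 ℤ.* d) ≡ (d ℤ.+ + 1) ℤ.* + 1 ℤ.- + 0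
    ring₆ = solve-∀

  -- A reduced matrix with h(∞) = 0 has determinant −1, hence is [[0, −1], [−1, d]].
  Reduced-base : ∀ {h} (R : Reduced h) → Reduced.j R ≡ 0 → InΓx x h
  Reduced-base {mat a b c d} R j≡0 with ℤ-unit b c bc≡1
    where
    open Reduced R
    a≡0 : a ≡ + 0
    a≡0 = trans a≡j (cong +_ j≡0)
    bc≡1 : b ℤ.* c ≡ + 1
    bc≡1 = ℤP.neg-injective (trans (sym (trans (cong (λ a → a ℤ.* d ℤ.- b ℤ.* c) a≡0) (ring d b c)))
                                   (det≢1 {mat a b c d} unimodular (λ det≡1 → notW₁ (j≡0 , det≡1))))
      where
      ring : ∀ d b c → + 0 ℤ.* d ℤ.- b ℤ.* c ≡ ℤ.- (b ℤ.* c)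
      ring = solve-∀
  ... | inj₁ (_ , c≡1) = ⊥-elim (-[1+k]≢1 (trans (sym (Reduced.c≡-k-1 R)) c≡1))
    where
    -[1+k]≢1 : -[1+ Reduced.k R ] ≢ + 1
    -[1+k]≢1 ()
  ... | inj₂ (b≡-1 , c≡-1) = subst (InΓx x) (sym h≡) (InΓx-base d (subst (λ g → Above g (+ 1)) h≡ (Reduced.above1 R)))
    where
    h≡ : mat a b c d ≡ mat (+ 0) -[1+ 0 ] -[1+ 0 ] d
    h≡ = mat-≡ (trans (Reduced.a≡j R) (cong +_ j≡0)) b≡-1 c≡-1 refl

  -- Every reduced matrix is ±γ_i for some i ≥ 1: descend through parents,
  -- the size k + j strictly decreasing, until h(∞) = 0.
  Reduced→InΓx : ∀ N {h} (R : Reduced h) → Reduced.k R ℕ.+ Reduced.j R ℕ.≤ N → InΓx x h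
  Reduced→InΓx N R size≤ with Reduced.j R in j≡
  ... | zero = Reduced-base R j≡
  Reduced→InΓx zero R size≤ | suc j0 = ⊥-elim (ℕP.n≮0 (subst (ℕ._≤ 0) (ℕP.+-suc (Reduced.k R) j0) size≤))
  Reduced→InΓx (suc N) {h} R size≤ | suc j0 =
    InΓx-parent (Multiplier.M μ) h (Reduced.above1 R)
      (Reduced→InΓx N (Reduced-parent R j≡ μ) (size-decreases (Multiplier.j′< μ) size≤))
    where
    μ : Multiplier (Reduced.k R) j0 (det h)
    μ = multiplier (Reduced.k R) j0 (det h) (subst (ℕ._≤ suc (Reduced.k R)) j≡ (Reduced.j≤k+1 R))
                   (λ { (j≡k , det≡-1) → Reduced.notW₂ R (trans j≡ j≡k , det≡-1) })

module Classification (x : Irrational) where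
  open Sign x
  open Reduction x

  W° : M2 → Set
  W° γ = W x γ × ¬ W₁ x γ × ¬ W₂ x γ

  W-neg : ∀ γ → W x γ → W x (negM γ)
  W-neg γ ((q , γ∞≡ , -1≤ , ≤0) , gt) =
    (q , trans (atInf-neg γ) γ∞≡ , -1≤ , ≤0) , Above→ActGt (negM γ) (+ 1) (Above-neg γ (+ 1) (ActGt→Above γ (+ 1) gt))

  W-neg⁻ : ∀ γ → W x (negM γ) → W x γ
  W-neg⁻ γ w = subst (W x) (negM-involutive γ) (W-neg (negM γ) w)

  W°-neg : ∀ γ → W° γ → W° (negM γ)
  W°-neg γ (w , ¬w₁ , ¬w₂) = W-neg γ w ,
    (λ { (w′ , γ∞≡ , det≡) → ¬w₁ (W-neg⁻ γ w′ , trans (sym (atInf-neg γ)) γ∞≡ , trans (sym (det-neg γ)) det≡) }) ,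
    (λ { (w′ , γ∞≡ , det≡) → ¬w₂ (W-neg⁻ γ w′ , trans (sym (atInf-neg γ)) γ∞≡ , trans (sym (det-neg γ)) det≡) })

  Reduced→W° : ∀ {h} → Reduced h → W° h
  Reduced→W° {h} R =
    (UnitRatio→InfInUnit h (k , j , j≤k+1 , inj₁ (a≡j , c≡-k-1)) , Above→ActGt h (+ 1) above1) ,
    (λ { (_ , h∞≡0 , det≡1) → notW₁ (ℤP.+-injective (trans (sym a≡j)
          (trans (atInf-integer h (+ 0) h∞≡0) (ℤP.*-zeroˡ (c h)))) , det≡1) }) ,
    (λ { (_ , h∞≡-1 , det≡-1) → notW₂ (ℤP.+-injective (trans (sym a≡j)
          (trans (atInf-integer h -[1+ 0 ] h∞≡-1) (trans (ℤP.-1*i≡-i (c h)) (cong ℤ.-_ c≡-k-1)))) , det≡-1) })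
    where open Reduced R

  W°→Reduced : ∀ γ k j → a γ ≡ + j → c γ ≡ -[1+ k ] → j ℕ.≤ suc k → Unimodular γ → W° γ → Reduced γ
  W°→Reduced γ k j a≡j c≡-k-1 j≤k+1 uni (w@(_ , gt) , ¬w₁ , ¬w₂) = record
    { k = k ; j = j ; a≡j = a≡j ; c≡-k-1 = c≡-k-1 ; j≤k+1 = j≤k+1
    ; above1 = ActGt→Above γ (+ 1) gt ; unimodular = uni
    ; notW₁ = λ { (refl , det≡1) → ¬w₁ (w , atInf-integer⁻ γ (+ 0) c≢0 (trans a≡j (sym (ℤP.*-zeroˡ (c γ)))) , det≡1) }
    ; notW₂ = λ { (refl , det≡-1) → ¬w₂ (w , atInf-integer⁻ γ -[1+ 0 ] c≢0
                    (trans a≡j (trans (cong ℤ.-_ (sym c≡-k-1)) (sym (ℤP.-1*i≡-i (c γ))))) , det≡-1) }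
    }
    where
    c≢0 : c γ ≢ + 0
    c≢0 c≡0 with trans (sym c≡-k-1) c≡0
    ... | ()

  W°→Reduced± : ∀ γ → Unimodular γ → W° γ → Reduced γ ⊎ Reduced (negM γ)
  W°→Reduced± γ uni w°@((γ∞ , _) , _) with InfInUnit→UnitRatio γ γ∞
  ... | k , j , j≤k+1 , inj₁ (a≡j , c≡-k-1) = inj₁ (W°→Reduced γ k j a≡j c≡-k-1 j≤k+1 uni w°)
  ... | k , j , j≤k+1 , inj₂ (a≡-j , c≡k+1) =
    inj₂ (W°→Reduced (negM γ) k j (trans (cong ℤ.-_ a≡-j) (ℤP.neg-involutive (+ j))) (cong ℤ.-_ c≡k+1) j≤k+1
                     (Unimodular-neg γ uni) (W°-neg γ w°))

  InΓx→W° : ∀ γ → InΓx x γ → W° γ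
  InΓx→W° γ (i , g , cf , g~γ) with CF→Reduced cf | g~γ
  ... | inj₁ R | inj₁ refl = Reduced→W° R
  ... | inj₁ R | inj₂ refl = W°-neg g (Reduced→W° R)
  ... | inj₂ R | inj₁ refl = subst W° (negM-involutive g) (W°-neg (negM g) (Reduced→W° R))
  ... | inj₂ R | inj₂ refl = Reduced→W° R

  W°→InΓx : ∀ γ → Unimodular γ → W° γ → InΓx x γ
  W°→InΓx γ uni w° with W°→Reduced± γ uni w°
  ... | inj₁ R = Reduced→InΓx _ R ℕP.≤-refl
  ... | inj₂ R = InΓx-neg γ (Reduced→InΓx _ R ℕP.≤-refl)

  x-above : ∀ lo q → below x q ≡ true → ℤ→ℚ lo ℚ.≤ q → LinPos (+ 1) (ℤ.- lo)
  x-above lo q bq lo≤q with noMax x q bq | inhabU x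
  ... | r , q<r , br | s , bs = linPos (r , s , br , bs , pos r lo<r , pos s (ℚP.<-trans lo<r (below<above r s br bs)))
    where
    lo<r = ℚP.≤-<-trans lo≤q q<r
    pos : ∀ u → ℤ→ℚ lo ℚ.< u → 0ℚ ℚ.< ℤ→ℚ (+ 1) ℚ.* u ℚ.+ ℤ→ℚ (ℤ.- lo)
    pos u lt = subst (0ℚ ℚ.<_) (sym (cong₂ ℚ._+_ (ℚP.*-identityˡ u) (ℤ→ℚ-neg lo))) (<⇒pos-diff (ℤ→ℚ lo) u lt)

  x-below : ∀ hi q → below x q ≡ false → q ℚ.≤ ℤ→ℚ hi → LinPos -[1+ 0 ] hi
  x-below hi q bq q≤hi with noMin x q bq | inhabL x
  ... | s , s<q , bs | r , br = linPos (r , s , br , bs , pos r (ℚP.<-trans (below<above r s br bs) s<hi) , pos s s<hi)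
    where
    s<hi = ℚP.<-≤-trans s<q q≤hi
    pos : ∀ u → u ℚ.< ℤ→ℚ hi → 0ℚ ℚ.< ℤ→ℚ -[1+ 0 ] ℚ.* u ℚ.+ ℤ→ℚ hi
    pos u lt = subst (0ℚ ℚ.<_) eq (<⇒pos-diff u (ℤ→ℚ hi) lt)
      where
      eq : ℤ→ℚ hi ℚ.- u ≡ ℤ→ℚ -[1+ 0 ] ℚ.* u ℚ.+ ℤ→ℚ hi
      eq = trans (ℚP.+-comm (ℤ→ℚ hi) (ℚ.- u))
                 (cong (ℚ._+ ℤ→ℚ hi) (trans (cong ℚ.-_ (sym (ℚP.*-identityˡ u))) (ℚP.neg-distribˡ-* 1ℚ u)))

  Ceiling : ℤ → Set
  Ceiling d = LinPos (+ 1) (+ 1 ℤ.- d) × LinPos -[1+ 0 ] d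

  ceiling-search : ∀ t lo → LinPos (+ 1) (ℤ.- lo) → LinPos -[1+ 0 ] (lo ℤ.+ + t) → Σ ℤ Ceiling
  ceiling-search zero lo x>lo x<lo = ⊥-elim (LinPos-zero (LinPos-cong refl (ring lo) (LinPos-+ x>lo x<lo)))
    where
    ring : ∀ lo → ℤ.- lo ℤ.+ (lo ℤ.+ + 0) ≡ + 0
    ring = solve-∀
  ceiling-search (suc t) lo x>lo x<lo+t+1 with LinPos-dichotomy {+ 1} {ℤ.- (lo ℤ.+ + 1)} (inj₁ (λ ()))
  ... | inj₁ x>lo+1 = ceiling-search t (lo ℤ.+ + 1) x>lo+1 (LinPos-cong refl (ring lo (+ t)) x<lo+t+1)
    where
    ring : ∀ lo t → lo ℤ.+ (+ 1 ℤ.+ t) ≡ lo ℤ.+ + 1 ℤ.+ t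
    ring = solve-∀
  ... | inj₂ x<lo+1 = lo ℤ.+ + 1 , LinPos-cong refl (ring lo) x>lo , LinPos-cong refl (ℤP.neg-involutive _) x<lo+1
    where
    ring : ∀ lo → ℤ.- lo ≡ + 1 ℤ.- (lo ℤ.+ + 1)
    ring = solve-∀

  ceiling-exists : Σ ℤ Ceiling
  ceiling-exists with inhabL x | inhabU x
  ... | q₀ , b₀ | q₁ , b₁ = ceiling-search (ℤ.∣ ℚ.↥ q₀ ∣ ℕ.+ ℤ.∣ ℚ.↥ q₁ ∣) (ℤ.- (+ ℤ.∣ ℚ.↥ q₀ ∣))
    (x-above (ℤ.- (+ ℤ.∣ ℚ.↥ q₀ ∣)) q₀ b₀ (ℚ-lower-int q₀))
    (LinPos-cong refl (sym (ring ℤ.∣ ℚ.↥ q₀ ∣ ℤ.∣ ℚ.↥ q₁ ∣))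
                 (x-below (+ ℤ.∣ ℚ.↥ q₁ ∣) q₁ b₁ (ℚ-upper-int q₁)))
    where
    ring : ∀ m n → ℤ.- (+ m) ℤ.+ + (m ℕ.+ n) ≡ + n
    ring m n = trans (cong (λ z → ℤ.- (+ m) ℤ.+ z) (ℤP.pos-+ m n)) (cancel (+ m) (+ n))
      where
      cancel : ∀ a b → ℤ.- a ℤ.+ (a ℤ.+ b) ≡ b
      cancel = solve-∀

  ceiling-unique : ∀ {d d′} → Ceiling d → Ceiling d′ → d ≡ d′
  ceiling-unique {d} {d′} (x>d-1 , x<d) (x>d′-1 , x<d′) = ℤP.≤-antisym (≤ x>d-1 x<d′) (≤ x>d′-1 x<d)
    where
    ≤ : ∀ {d d′} → LinPos (+ 1) (+ 1 ℤ.- d) → LinPos -[1+ 0 ] d′ → d ℤ.≤ d′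
    ≤ {d} {d′} l l′ = ℤP.0≤i-j⇒j≤i (ℤ-pos-suc (d′ ℤ.- d) (subst (+ 0 ℤ.<_) (ring d d′) (LinPos-const (LinPos-+ l l′))))
      where
      ring : ∀ d d′ → + 1 ℤ.- d ℤ.+ d′ ≡ + 1 ℤ.+ (d′ ℤ.- d)
      ring = solve-∀

  -- The candidates for W₁: γ = [[0, 1], [−1, d]], with γ(∞) = 0, det γ = 1
  -- and γ(x) = 1/(d − x), which exceeds 1 iff d is the ceiling of x.
  W₁-matrix : ℤ → M2
  W₁-matrix d = mat (+ 0) (+ 1) -[1+ 0 ] d

  W₁-matrix-above : ∀ d → Above (W₁-matrix d) (+ 1) → Ceiling d
  W₁-matrix-above d (inj₁ (l₁ , l₂)) = LinPos-cong refl (ring d) l₁ , l₂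
    where
    ring : ∀ d → + 1 ℤ.- + 1 ℤ.* d ≡ + 1 ℤ.- d
    ring = solve-∀
  W₁-matrix-above d (inj₂ (l₁ , l₂)) = ⊥-elim (contra (LinPos-const (LinPos-cong refl (ring d) (LinPos-+ l₁ l₂))))
    where
    ring : ∀ d → ℤ.- (+ 1 ℤ.- + 1 ℤ.* d) ℤ.+ ℤ.- d ≡ -[1+ 0 ]
    ring = solve-∀
    contra : ¬ (+ 0 ℤ.< -[1+ 0 ])
    contra ()

  W₁-matrix-above⁻ : ∀ d → Ceiling d → Above (W₁-matrix d) (+ 1)
  W₁-matrix-above⁻ d (l₁ , l₂) = inj₁ (LinPos-cong refl (ring d) l₁ , l₂)
    where
    ring : ∀ d → + 1 ℤ.- d ≡ + 1 ℤ.- + 1 ℤ.* d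
    ring = solve-∀

  W₁-normal : ∀ δ → W₁ x δ → Σ ℤ λ d → δ ~ W₁-matrix d × Ceiling d
  W₁-normal (mat a b c d) ((_ , gt) , δ∞≡0 , det≡1)
    with trans (atInf-integer (mat a b c d) (+ 0) δ∞≡0) (ℤP.*-zeroˡ c)
  ... | refl with ℤ-unit (ℤ.- b) c (trans (ring b c d) det≡1)
    where
    ring : ∀ b c d → ℤ.- b ℤ.* c ≡ + 0 ℤ.* d ℤ.- b ℤ.* c
    ring = solve-∀
  ...   | inj₁ (-b≡1 , refl) with ℤP.neg-injective {b} { -[1+ 0 ]} -b≡1
  ...     | refl = ℤ.- d , inj₂ refl , W₁-matrix-above (ℤ.- d) (Above-neg δ (+ 1) (ActGt→Above δ (+ 1) gt))
    where
    δ = mat (+ 0) -[1+ 0 ] (+ 1) d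
  W₁-normal (mat a b c d) ((_ , gt) , δ∞≡0 , det≡1) | refl | inj₂ (-b≡-1 , refl) with ℤP.neg-injective {b} {+ 1} -b≡-1
  ...     | refl = d , inj₁ refl , W₁-matrix-above d (ActGt→Above (W₁-matrix d) (+ 1) gt)

  W₁-exactly-one : ∃ λ γ → Unimodular γ × W₁ x γ × (∀ δ → Unimodular δ → W₁ x δ → δ ~ γ)
  W₁-exactly-one =
    let (d , x≈d) = ceiling-exists in
    W₁-matrix d , inj₁ refl ,
    ((UnitRatio→InfInUnit (W₁-matrix d) (0 , 0 , ℕ.z≤n , inj₁ (refl , refl)) ,
      Above→ActGt (W₁-matrix d) (+ 1) (W₁-matrix-above⁻ d x≈d)) , refl , refl) ,
    λ δ _ δ∈W₁ → let (d′ , δ~ , x≈d′) = W₁-normal δ δ∈W₁ in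
                 subst (λ e → δ ~ W₁-matrix e) (ceiling-unique x≈d′ x≈d) δ~

  HalfCeiling : ℤ → Set
  HalfCeiling b = LinPos (+ 1) (+ 1 ℤ.- b) × LinPos (ℤ.- (+ 2)) (+ 2 ℤ.* b ℤ.- + 1)

  halfCeiling-unique : ∀ {b b′} → HalfCeiling b → HalfCeiling b′ → b ≡ b′
  halfCeiling-unique (x>b-1 , x<b-½) (x>b′-1 , x<b′-½) = ℤP.≤-antisym (≤ x>b-1 x<b′-½) (≤ x>b′-1 x<b-½)
    where
    ≤ : ∀ {b b′} → LinPos (+ 1) (+ 1 ℤ.- b) → LinPos (ℤ.- (+ 2)) (+ 2 ℤ.* b′ ℤ.- + 1) → b ℤ.≤ b′
    ≤ {b} {b′} l l′ = ℤP.0≤i-j⇒j≤i (ℤ-nonneg-double (b′ ℤ.- b) (ℤ-pos-suc (+ 2 ℤ.* (b′ ℤ.- b))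
      (subst (+ 0 ℤ.<_) (ring b b′) (LinPos-const (LinPos-cong refl refl (LinPos-+ (LinPos-+ l l) l′))))))
      where
      ring : ∀ b b′ → + 1 ℤ.- b ℤ.+ (+ 1 ℤ.- b) ℤ.+ (+ 2 ℤ.* b′ ℤ.- + 1) ≡ + 1 ℤ.+ + 2 ℤ.* (b′ ℤ.- b)
      ring = solve-∀

  -- The candidates for W₂: γ = [[−1, b], [1, d]] with b + d = 1, so that
  -- γ(∞) = −1, det γ = −1 and γ(x) = (b − x)/(x + 1 − b) > 1 iff b is
  -- the half-ceiling of x.
  W₂-matrix : ℤ → ℤ → M2
  W₂-matrix b d = mat -[1+ 0 ] b (+ 1) d

  W₂-matrix-above : ∀ b d → b ℤ.+ d ≡ + 1 → Above (W₂-matrix b d) (+ 1) → HalfCeiling b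
  W₂-matrix-above b d b+d≡1 (inj₁ (l₁ , l₂)) =
    LinPos-cong refl (trans (sym (ℤ-add-sub b d)) (cong (ℤ._- b) b+d≡1)) l₂ ,
    LinPos-cong refl (trans (ring b d) (cong (λ w → + 2 ℤ.* b ℤ.- w) b+d≡1)) l₁
    where
    ring : ∀ b d → b ℤ.- + 1 ℤ.* d ≡ + 2 ℤ.* b ℤ.- (b ℤ.+ d)
    ring = solve-∀
  W₂-matrix-above b d b+d≡1 (inj₂ (l₁ , l₂)) =
    ⊥-elim (contra (LinPos-const (LinPos-cong refl (trans (ring b d) (cong ℤ.-_ b+d≡1)) (LinPos-+ l₁ (LinPos-+ l₂ l₂)))))
    where
    ring : ∀ b d → ℤ.- (b ℤ.- + 1 ℤ.* d) ℤ.+ (ℤ.- d ℤ.+ ℤ.- d) ≡ ℤ.- (b ℤ.+ d)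
    ring = solve-∀
    contra : ¬ (+ 0 ℤ.< -[1+ 0 ])
    contra ()

  W₂-normal : ∀ δ → W₂ x δ → Σ ℤ λ b → Σ ℤ λ d → δ ~ W₂-matrix b d × b ℤ.+ d ≡ + 1 × HalfCeiling b
  W₂-normal (mat a b c d) ((_ , gt) , δ∞≡-1 , det≡-1)
    with trans (atInf-integer (mat a b c d) -[1+ 0 ] δ∞≡-1) (ℤP.-1*i≡-i c)
  ... | refl with ℤ-unit c (b ℤ.+ d) (ℤP.neg-injective (trans (ring b c d) det≡-1))
    where
    ring : ∀ b c d → ℤ.- (c ℤ.* (b ℤ.+ d)) ≡ ℤ.- c ℤ.* d ℤ.- b ℤ.* c
    ring = solve-∀
  ...   | inj₁ (refl , b+d≡1) = b , d , inj₁ refl , b+d≡1 , W₂-matrix-above b d b+d≡1 (ActGt→Above (W₂-matrix b d) (+ 1) gt)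
  ...   | inj₂ (refl , b+d≡-1) = ℤ.- b , ℤ.- d , inj₂ refl , -b-d≡1 ,
      W₂-matrix-above (ℤ.- b) (ℤ.- d) -b-d≡1 (Above-neg δ (+ 1) (ActGt→Above δ (+ 1) gt))
    where
    δ = mat (+ 1) b -[1+ 0 ] d
    -b-d≡1 : ℤ.- b ℤ.+ ℤ.- d ≡ + 1
    -b-d≡1 = trans (sym (ℤP.neg-distrib-+ b d)) (cong ℤ.-_ b+d≡-1)

  W₂-at-most-one : ∀ δ δ′ → Unimodular δ → Unimodular δ′ → W₂ x δ → W₂ x δ′ → δ ~ δ′
  W₂-at-most-one δ δ′ _ _ δ∈W₂ δ′∈W₂ =
    let (b , d , δ~ , b+d≡1 , x≈b) = W₂-normal δ δ∈W₂
        (b′ , d′ , δ′~ , b′+d′≡1 , x≈b′) = W₂-normal δ′ δ′∈W₂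
        b≡b′ = halfCeiling-unique x≈b x≈b′
        d≡d′ = trans (sym (ℤ-add-sub b d)) (trans (cong₂ ℤ._-_ (trans b+d≡1 (sym b′+d′≡1)) b≡b′) (ℤ-add-sub b′ d′))
    in ~-trans δ~ (subst₂ (λ u v → W₂-matrix u v ~ δ′) (sym b≡b′) (sym d≡d′) (~-sym δ′~))

theorem1 : (x : Irrational) →
    (∀ γ → Unimodular γ → (InΓx x γ ⇔ (W x γ × ¬ W₁ x γ × ¬ W₂ x γ)))
    × (∃ λ γ → Unimodular γ × W₁ x γ × (∀ δ → Unimodular δ → W₁ x δ → δ ~ γ))
    × (∀ δ δ′ → Unimodular δ → Unimodular δ′ → W₂ x δ → W₂ x δ′ → δ ~ δ′)
theorem1 x = (λ γ uni → mk⇔ (InΓx→W° γ) (W°→InΓx γ uni)) , W₁-exactly-one , W₂-at-most-one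
  where open Classification x
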